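{- $U_{2,4} \oplus U_{2,4}$ is an excluded minor for $\mathcal{M}_2$; that is, $U_{2,4} \oplus U_{2,4} \notin \mathcal{M}_2$, but every proper minor of $U_{2,4} \oplus U_{2,4}$ is in $\mathcal{M}_2$.
   Context: An integer matrix $A$ is $2$-modular if the determinant of every $\operatorname{rank}(A) \times \operatorname{rank}(A)$ submatrix has absolute value at most $2$. $\mathcal{M}_2$ is the class of matroids that are isomorphic to the vector matroid (over $\mathbb{R}$, on the columns) of some $2$-modular matrix. -}

module Defs where

open import Data.Nat using (ℕ; zero; suc; _+_)
import Data.Nat as ℕ
open import Data.Integer using (ℤ; 0ℤ; 1ℤ; -_; _*_)
import Data.Integer as ℤ
open import Data.Fin using (Fin; zero; suc; punchIn)
open import Data.Fin.Subset using (Subset; _∈_; _∉_; _⊆_; ∁; _∩_; _∪_; ⁅_⁆; ∣_∣; Nonempty; Empty; ⊤)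
open import Data.Vec using (Vec; take; drop; tabulate; lookup)
open import Data.Product using (Σ; ∃; _×_)
open import Relation.Nullary using (¬_)
open import Relation.Binary.PropositionalEquality using (_≡_)
open import Function.Bundles using (_⇔_)
open import Function.Definitions using (Injective)

IndepSys : ℕ → Set₁
IndepSys n = Subset n → Set

U : (r n : ℕ) → IndepSys n
U r n X = ∣ X ∣ ℕ.≤ r

_⊕_ : ∀ {a b} → IndepSys a → IndepSys b → IndepSys (a + b)
_⊕_ {a} M N X = M (take a X) × N (drop a X)

-- The minor M / C \ D (C, D disjoint), on ground set ∁ (C ∪ D) ⊆ Fin n.
-- X is independent iff X avoids C ∪ D and X ∪ B is independent in M,
-- for some basis (maximal independent subset) B of C.
IsBasisOf : ∀ {n} → IndepSys n → Subset n → Subset n → Set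
IsBasisOf M C B = B ⊆ C × M B × (∀ e → e ∈ C → e ∉ B → ¬ M (⁅ e ⁆ ∪ B))

minor : ∀ {n} → IndepSys n → (C D : Subset n) → IndepSys n
minor M C D X = X ⊆ ∁ (C ∪ D) × ∃ λ B → IsBasisOf M C B × M (X ∪ B)

Mat : ℕ → ℕ → Set
Mat m k = Fin m → Fin k → ℤ

sumFin : ∀ {k} → (Fin k → ℤ) → ℤ
sumFin {zero} f = 0ℤ
sumFin {suc k} f = f zero ℤ.+ sumFin (λ j → f (suc j))

sgn : ℕ → ℤ
sgn zero = 1ℤ
sgn (suc i) = - sgn i

det : ∀ {k} → Mat k k → ℤ
det {zero} M = 1ℤ
det {suc k} M =
  sumFin (λ j → sgn (Data.Fin.toℕ j) * M zero j * det (λ r c → M (suc r) (punchIn j c)))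

-- A set S of columns of A is linearly independent (over ℝ; equivalently,
-- since A is integral, no nonzero integer combination of them vanishes).
ColIndep : ∀ {m k} → Mat m k → Subset k → Set
ColIndep {m} {k} A S =
  (λ' : Fin k → ℤ) → (∀ j → j ∉ S → λ' j ≡ 0ℤ) →
  (∀ i → sumFin (λ j → A i j * λ' j) ≡ 0ℤ) → ∀ j → λ' j ≡ 0ℤ

VecMatroid : ∀ {m k} → Mat m k → IndepSys k
VecMatroid A = ColIndep A

IsRank : ∀ {m k} → Mat m k → ℕ → Set
IsRank A r = (∃ λ S → ColIndep A S × ∣ S ∣ ≡ r) × (∀ S → ColIndep A S → ∣ S ∣ ℕ.≤ r)

-- Every rank(A) × rank(A) submatrix has determinant of absolute value ≤ 2.
-- (Row/column selections given as maps Fin r → …; non-injective selections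
-- give determinant 0, and reordering only changes the sign.)
TwoModular : ∀ {m k} → Mat m k → Set
TwoModular {m} {k} A = ∀ r → IsRank A r →
  (rows : Fin r → Fin m) (cols : Fin r → Fin k) →
  ℤ.∣ det (λ a b → A (rows a) (cols b)) ∣ ℕ.≤ 2

-- Membership in 𝓜₂ for a set system I with ground set E ⊆ Fin n:
-- (E, I) is isomorphic to the vector matroid of some 2-modular matrix,
-- the isomorphism being a bijection f : Fin k → E.

preimage : ∀ {k n} → (Fin k → Fin n) → Subset n → Subset k
preimage f X = tabulate (λ j → lookup X (f j))

InM₂ : ∀ {n} → Subset n → IndepSys n → Set
InM₂ {n} E I =
  Σ ℕ λ k → Σ ℕ λ m → Σ (Mat m k) λ A → TwoModular A ×
  Σ (Fin k → Fin n) λ f → Injective _≡_ _≡_ f × (∀ j → f j ∈ E) ×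
  (∀ x → x ∈ E → ∃ λ j → f j ≡ x) ×
  (∀ X → X ⊆ E → (I X ⇔ VecMatroid A (preimage f X)))

U24⊕U24 : IndepSys 8
U24⊕U24 = U 2 4 ⊕ U 2 4

{-# OPTIONS --safe #-}
-- Suppose A is a 2-modular representation of U₂,₄ ⊕ U₂,₄, the elements 0-3 and 4-7 forming the two
-- copies. Then A has rank 4, and on some four rows the columns 0, 1, 4, 5 have a nonzero determinant D.
-- On these rows every column of the first copy is a combination of columns 0 and 1, and every column of
-- the second copy one of columns 4 and 5, so for x, y in the first copy and z, w in the second,
-- det(x y z w) · D = det(x y 4 5) · det(0 1 z w). The numbers det(x y 4 5) satisfy the three-term
-- Plücker relation, so, being ±1 or ±2, they cannot all have the absolute value of D = det(0 1 4 5);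
-- likewise for det(0 1 z w). For such x, y, z, w either |D| = 1 and |det(x y z w)| = 4, or |D| = 2 and
-- 2 |det(x y z w)| = 1.
-- A proper minor of U₂,₄ ⊕ U₂,₄ is the direct sum of two minors of U₂,₄, that is of two uniform
-- matroids U_{r,n} with r ≤ 2, n ≤ 4, not both equal to U₂,₄. Each such sum is represented by a
-- block-diagonal matrix, and that this matrix is 2-modular and represents the sum is checked by
-- computation, with nonzero maximal minors certifying independence and vanishing minors of circuits
-- certifying dependence.
module Submission where

open import Defs
open import Data.Bool using (true; false; _∨_; not)
open import Data.Empty using (⊥-elim)
open import Data.Fin using (Fin; zero; suc; toℕ; inject₁; punchIn; punchOut; fromℕ<; _↑ˡ_; _↑ʳ_; splitAt; join)
open import Data.Fin.Patterns using (0F; 1F; 2F; 3F; 4F; 5F; 6F; 7F)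
open import Data.Fin.Properties
  using (punchInᵢ≢i; punchIn-injective; punchIn-punchOut; toℕ-inject₁; toℕ-injective; toℕ<n; toℕ-fromℕ<; pigeonhole;
         punchOut-injective; any?; all?; suc-injective; <⇒≢; injective⇒≤; ↑ˡ-injective; ↑ʳ-injective;
         splitAt-↑ˡ; splitAt-↑ʳ; splitAt-join; join-splitAt; splitAt⁻¹-↑ˡ; splitAt⁻¹-↑ʳ)
  renaming (_≟_ to _≟ᶠ_)
open import Data.Fin.Subset using (Subset; _∈_; _∉_; _⊆_; ∁; _∪_; _∩_; ⁅_⁆; ∣_∣; ⊥; ⊤; Nonempty; Empty)
open import Data.Fin.Subset.Properties using (_∈?_; _⊆?_; anySubset?; ∈⊤; ∣p∣≡n⇒p≡⊤; x∈p⇒x∉∁p; ∪-identityˡ)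
open import Data.Integer using (ℤ; 0ℤ; 1ℤ; -1ℤ; -_; _+_; _-_; _*_; ≢-nonZero)
import Data.Integer as ℤ
open import Data.Integer.Properties
  using (_≟_; *-zeroʳ; *-zeroˡ; *-identityˡ; +-identityˡ; +-identityʳ; -1*i≡-i; i*j≡0⇒i≡0∨j≡0; +-inverseʳ;
         neg-involutive; *-comm; *-assoc; *-cancelˡ-≡; ∣-i∣≡∣i∣; abs-*; ∣i∣≡0⇒i≡0; +-injective; +-*-semiring)
open import Data.Integer.Tactic.RingSolver using (solve-∀)
open import Algebra.Properties.Semiring.Sum +-*-semiring using (sum; sum-cong-≗; ∑-distrib-+; ∑-comm; *-distribˡ-sum)
open import Data.Nat as ℕ using (ℕ; zero; suc; _∸_; _⊓_)
import Data.Nat.Properties as ℕ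
open import Data.Product using (∃; ∃₂; _×_; _,_; proj₁; proj₂)
open import Data.Product.Properties using (≡-dec)
open import Data.Product.Function.NonDependent.Propositional using (_×-⇔_)
open import Data.Sum as Sum using (_⊎_; inj₁; inj₂)
open import Data.Sum.Properties using (inj₁-injective; inj₂-injective)
open import Data.Vec as Vec using (Vec; here; there; lookup; tabulate; take; drop; _++_)
open import Data.Vec.Properties
  using (lookup∘tabulate; tabulate∘lookup; tabulate-cong; []=⇒lookup; lookup⇒[]=; take-zipWith; drop-zipWith;
         take-map; drop-map; take++drop≡id; ++-injectiveˡ; ++-injectiveʳ; lookup-++ˡ; lookup-++ʳ)
open import Data.Vec.Functional using (_∷_; [])
open import Function using (_∘_; id)
open import Function.Bundles using (_⇔_; mk⇔; Equivalence)
open import Function.Definitions using (Injective)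
open import Function.Properties.Equivalence using () renaming (trans to ⇔-trans)
open import Relation.Binary.Definitions using (tri<; tri≈; tri>)
open import Relation.Binary.PropositionalEquality
open import Relation.Nullary using (¬_; Dec; yes; no; ¬?; does)
open import Relation.Nullary.Decidable
  using (_×-dec_; _⊎-dec_; _→-dec_; map′; decidable-stable; from-yes; True; False; toWitness; toWitnessFalse)
open ≡-Reasoning


sumFin≡sum : ∀ {k} (f : Fin k → ℤ) → sumFin f ≡ sum f
sumFin≡sum {zero} f = refl
sumFin≡sum {suc k} f = cong (f zero +_) (sumFin≡sum (f ∘ suc))

sumFin-cong : ∀ {k} {f g : Fin k → ℤ} → f ≗ g → sumFin f ≡ sumFin g
sumFin-cong {zero} f≗g = refl
sumFin-cong {suc k} f≗g = cong₂ _+_ (f≗g zero) (sumFin-cong (f≗g ∘ suc))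

sumFin-zero : ∀ {k} {f : Fin k → ℤ} → (∀ j → f j ≡ 0ℤ) → sumFin f ≡ 0ℤ
sumFin-zero {zero} f≡0 = refl
sumFin-zero {suc k} f≡0 = cong₂ _+_ (f≡0 zero) (sumFin-zero (f≡0 ∘ suc))

sumFin-+ : ∀ {k} (f g : Fin k → ℤ) → sumFin (λ j → f j + g j) ≡ sumFin f + sumFin g
sumFin-+ f g = begin
  sumFin (λ j → f j + g j)  ≡⟨ sumFin≡sum (λ j → f j + g j) ⟩
  sum (λ j → f j + g j)     ≡⟨ ∑-distrib-+ f g ⟩
  sum f + sum g             ≡⟨ cong₂ _+_ (sumFin≡sum f) (sumFin≡sum g) ⟨
  sumFin f + sumFin g       ∎

sumFin-*ˡ : ∀ {k} x (f : Fin k → ℤ) → sumFin (λ j → x * f j) ≡ x * sumFin f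
sumFin-*ˡ x f = begin
  sumFin (λ j → x * f j)  ≡⟨ sumFin≡sum (λ j → x * f j) ⟩
  sum (λ j → x * f j)     ≡⟨ *-distribˡ-sum x f ⟨
  x * sum f               ≡⟨ cong (x *_) (sumFin≡sum f) ⟨
  x * sumFin f            ∎

sumFin-neg : ∀ {k} (f : Fin k → ℤ) → sumFin (λ j → - f j) ≡ - sumFin f
sumFin-neg f = begin
  sumFin (λ j → - f j)       ≡⟨ sumFin-cong (λ j → -1*i≡-i (f j)) ⟨
  sumFin (λ j → -1ℤ * f j)   ≡⟨ sumFin-*ˡ -1ℤ f ⟩
  -1ℤ * sumFin f             ≡⟨ -1*i≡-i _ ⟩
  - sumFin f                 ∎

sumFin-linear : ∀ {k} x y (f g : Fin k → ℤ) →
  sumFin (λ j → x * f j + y * g j) ≡ x * sumFin f + y * sumFin g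
sumFin-linear x y f g =
  trans (sumFin-+ (λ j → x * f j) (λ j → y * g j)) (cong₂ _+_ (sumFin-*ˡ x f) (sumFin-*ˡ y g))

sumFin-comm : ∀ {k l} (F : Fin k → Fin l → ℤ) →
  sumFin (λ i → sumFin (F i)) ≡ sumFin (λ j → sumFin (λ i → F i j))
sumFin-comm F = begin
  sumFin (λ i → sumFin (F i))             ≡⟨ double F ⟩
  sum (λ i → sum (F i))                   ≡⟨ ∑-comm F ⟩
  sum (λ j → sum (λ i → F i j))           ≡⟨ double (λ j i → F i j) ⟨
  sumFin (λ j → sumFin (λ i → F i j))     ∎
  where
  double : ∀ {k l} (G : Fin k → Fin l → ℤ) → sumFin (λ i → sumFin (G i)) ≡ sum (λ i → sum (G i))
  double G = trans (sumFin≡sum (λ i → sumFin (G i))) (sum-cong-≗ (sumFin≡sum ∘ G))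

sumFin-single : ∀ {k} (f : Fin k → ℤ) a → (∀ b → b ≢ a → f b ≡ 0ℤ) → sumFin f ≡ f a
sumFin-single {suc k} f zero off = trans (cong (f zero +_) (sumFin-zero (λ b → off (suc b) λ ()))) (+-identityʳ _)
sumFin-single {suc k} f (suc a) off =
  trans (cong₂ _+_ (off zero λ ()) (sumFin-single (f ∘ suc) a (λ b b≢a → off (suc b) (b≢a ∘ suc-injective))))
        (+-identityˡ _)

-- Determinants

x≡-x⇒x≡0 : ∀ {x} → x ≡ - x → x ≡ 0ℤ
x≡-x⇒x≡0 {x} x≡-x with i*j≡0⇒i≡0∨j≡0 (ℤ.+ 2) {x} 2x≡0
  where
  2x≡0 : ℤ.+ 2 * x ≡ 0ℤ
  2x≡0 = begin
    ℤ.+ 2 * x  ≡⟨ double x ⟩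
    x + x      ≡⟨ cong (x +_) x≡-x ⟩
    x + - x    ≡⟨ +-inverseʳ x ⟩
    0ℤ         ∎
    where
    double : ∀ x → ℤ.+ 2 * x ≡ x + x
    double = solve-∀
... | inj₁ ()
... | inj₂ x≡0 = x≡0

submatrix : ∀ {k} → Mat (suc k) (suc k) → Fin (suc k) → Mat k k
submatrix M j r c = M (suc r) (punchIn j c)

laplaceTerm : ∀ {k} → Mat (suc k) (suc k) → Fin (suc k) → ℤ
laplaceTerm M j = sgn (toℕ j) * M zero j * det (submatrix M j)

det-cong : ∀ {k} {M N : Mat k k} → (∀ r c → M r c ≡ N r c) → det M ≡ det N
det-cong {zero} M≈N = refl
det-cong {suc k} M≈N = sumFin-cong λ j →
  cong₂ (λ m d → sgn (toℕ j) * m * d) (M≈N zero j) (det-cong (λ r c → M≈N (suc r) (punchIn j c)))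

det-linear-column : ∀ {k} (a : Fin k) {M N P : Mat k k} x y →
  (∀ r c → c ≢ a → M r c ≡ P r c) → (∀ r c → c ≢ a → N r c ≡ P r c) →
  (∀ r → P r a ≡ x * M r a + y * N r a) → det P ≡ x * det M + y * det N
det-linear-column {suc k} a {M} {N} {P} x y M≈P N≈P Pₐ =
  trans (sumFin-cong term) (sumFin-linear x y (laplaceTerm M) (laplaceTerm N))
  where
  term : ∀ j → laplaceTerm P j ≡ x * laplaceTerm M j + y * laplaceTerm N j
  term j with j ≟ᶠ a
  ... | yes refl = begin
    s * P zero j * det (submatrix P j)                                    ≡⟨ cong (λ p → s * p * det (submatrix P j)) (Pₐ zero) ⟩
    s * (x * M zero j + y * N zero j) * det (submatrix P j)               ≡⟨ distrib s x y (M zero j) (N zero j) (det (submatrix P j)) ⟩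
    x * (s * M zero j * det (submatrix P j)) + y * (s * N zero j * det (submatrix P j))
      ≡⟨ cong₂ (λ d e → x * (s * M zero j * d) + y * (s * N zero j * e)) (sub-agree M≈P) (sub-agree N≈P) ⟩
    x * laplaceTerm M j + y * laplaceTerm N j                             ∎
    where
    s = sgn (toℕ j)
    sub-agree : ∀ {Q} → (∀ r c → c ≢ a → Q r c ≡ P r c) → det (submatrix P j) ≡ det (submatrix Q j)
    sub-agree Q≈P = det-cong λ r c → sym (Q≈P (suc r) (punchIn j c) (punchInᵢ≢i j c))
    distrib : ∀ s x y m n d → s * (x * m + y * n) * d ≡ x * (s * m * d) + y * (s * n * d)
    distrib = solve-∀
  ... | no j≢a = begin
    s * P zero j * det (submatrix P j)                                    ≡⟨ cong (s * P zero j *_) minor-linear ⟩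
    s * P zero j * (x * det (submatrix M j) + y * det (submatrix N j))    ≡⟨ distrib s (P zero j) x y _ _ ⟩
    x * (s * P zero j * det (submatrix M j)) + y * (s * P zero j * det (submatrix N j))
      ≡⟨ cong₂ (λ m n → x * (s * m * det (submatrix M j)) + y * (s * n * det (submatrix N j))) (sym (M≈P zero j j≢a)) (sym (N≈P zero j j≢a)) ⟩
    x * laplaceTerm M j + y * laplaceTerm N j                             ∎
    where
    s = sgn (toℕ j)
    a′ = punchOut j≢a
    avoids : ∀ {c} → c ≢ a′ → punchIn j c ≢ a
    avoids c≢a′ eq = c≢a′ (punchIn-injective j _ a′ (trans eq (sym (punchIn-punchOut j≢a))))
    minor-linear : det (submatrix P j) ≡ x * det (submatrix M j) + y * det (submatrix N j)
    minor-linear = det-linear-column a′ x y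
      (λ r c c≢a′ → M≈P (suc r) (punchIn j c) (avoids c≢a′))
      (λ r c c≢a′ → N≈P (suc r) (punchIn j c) (avoids c≢a′))
      (λ r → subst (λ c → P (suc r) c ≡ x * M (suc r) c + y * N (suc r) c) (sym (punchIn-punchOut j≢a)) (Pₐ (suc r)))
    distrib : ∀ s p x y d e → s * p * (x * d + y * e) ≡ x * (s * p * d) + y * (s * p * e)
    distrib = solve-∀

adjSwap : ∀ {k} → Fin k → Fin (suc k) → Fin (suc k)
adjSwap zero    zero          = suc zero
adjSwap zero    (suc zero)    = zero
adjSwap zero    (suc (suc c)) = suc (suc c)
adjSwap (suc i) zero          = zero
adjSwap (suc i) (suc c)       = suc (adjSwap i c)

adjSwap-inject₁ : ∀ {k} (i : Fin k) → adjSwap i (inject₁ i) ≡ suc i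
adjSwap-inject₁ zero    = refl
adjSwap-inject₁ (suc i) = cong suc (adjSwap-inject₁ i)

adjSwap-suc : ∀ {k} (i : Fin k) → adjSwap i (suc i) ≡ inject₁ i
adjSwap-suc zero    = refl
adjSwap-suc (suc i) = cong suc (adjSwap-suc i)

adjSwap-fix : ∀ {k} (i : Fin k) {c} → c ≢ inject₁ i → c ≢ suc i → adjSwap i c ≡ c
adjSwap-fix zero    {zero}          c≢i c≢i+1 = ⊥-elim (c≢i refl)
adjSwap-fix zero    {suc zero}      c≢i c≢i+1 = ⊥-elim (c≢i+1 refl)
adjSwap-fix zero    {suc (suc c)}   c≢i c≢i+1 = refl
adjSwap-fix (suc i) {zero}          c≢i c≢i+1 = refl
adjSwap-fix (suc i) {suc c}         c≢i c≢i+1 = cong suc (adjSwap-fix i (c≢i ∘ cong suc) (c≢i+1 ∘ cong suc))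

adjSwap-involutive : ∀ {k} (i : Fin k) c → adjSwap i (adjSwap i c) ≡ c
adjSwap-involutive zero    zero          = refl
adjSwap-involutive zero    (suc zero)    = refl
adjSwap-involutive zero    (suc (suc c)) = refl
adjSwap-involutive (suc i) zero          = refl
adjSwap-involutive (suc i) (suc c)       = cong suc (adjSwap-involutive i c)

adjSwap-punchIn-inject₁ : ∀ {k} (i c : Fin k) → adjSwap i (punchIn (inject₁ i) c) ≡ punchIn (suc i) c
adjSwap-punchIn-inject₁ zero    zero    = refl
adjSwap-punchIn-inject₁ zero    (suc c) = refl
adjSwap-punchIn-inject₁ (suc i) zero    = refl
adjSwap-punchIn-inject₁ (suc i) (suc c) = cong suc (adjSwap-punchIn-inject₁ i c)

adjSwap-punchIn-suc : ∀ {k} (i c : Fin k) → adjSwap i (punchIn (suc i) c) ≡ punchIn (inject₁ i) c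
adjSwap-punchIn-suc zero    zero    = refl
adjSwap-punchIn-suc zero    (suc c) = refl
adjSwap-punchIn-suc (suc i) zero    = refl
adjSwap-punchIn-suc (suc i) (suc c) = cong suc (adjSwap-punchIn-suc i c)

sumFin-adjSwap : ∀ {k} (i : Fin k) (f : Fin (suc k) → ℤ) → sumFin (f ∘ adjSwap i) ≡ sumFin f
sumFin-adjSwap zero    f = +-left-comm (f (suc zero)) (f zero) _
  where
  +-left-comm : ∀ a b c → a + (b + c) ≡ b + (a + c)
  +-left-comm = solve-∀
sumFin-adjSwap (suc i) f = cong (f zero +_) (sumFin-adjSwap i (f ∘ suc))

-- Away from the swapped pair, deleting column j commutes with the swap, which then acts on the
-- remaining columns as another adjacent swap.
data AdjSwapView {k} (i : Fin (suc k)) : Fin (suc (suc k)) → Set where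
  left  : AdjSwapView i (inject₁ i)
  right : AdjSwapView i (suc i)
  other : ∀ {j} (i′ : Fin k) → adjSwap i j ≡ j →
          (∀ c → adjSwap i (punchIn j c) ≡ punchIn j (adjSwap i′ c)) → AdjSwapView i j

adjSwapView : ∀ {k} (i : Fin (suc k)) j → AdjSwapView i j
adjSwapView zero zero = left
adjSwapView zero (suc zero) = right
adjSwapView {suc k} zero (suc (suc j)) = other zero refl λ { zero → refl ; (suc zero) → refl ; (suc (suc c)) → refl }
adjSwapView (suc i) zero = other i refl λ c → refl
adjSwapView {suc k} (suc i) (suc j) with adjSwapView i j
... | left = left
... | right = right
... | other i′ fixed commutes = other (suc i′) (cong suc fixed) λ { zero → refl ; (suc c) → cong suc (commutes c) }

det-swap-adjacent-columns : ∀ {k} (i : Fin k) (M N : Mat (suc k) (suc k)) →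
  (∀ r c → N r c ≡ M r (adjSwap i c)) → det N ≡ - det M
det-swap-adjacent-columns {suc k} i M N N≈M = begin
  sumFin (laplaceTerm N)                         ≡⟨ sumFin-cong term ⟩
  sumFin (λ j → - laplaceTerm M (adjSwap i j))   ≡⟨ sumFin-neg (laplaceTerm M ∘ adjSwap i) ⟩
  - sumFin (laplaceTerm M ∘ adjSwap i)           ≡⟨ cong -_ (sumFin-adjSwap i (laplaceTerm M)) ⟩
  - sumFin (laplaceTerm M)                       ∎
  where
  flip-sign : ∀ s m d → s * m * d ≡ - (- s * m * d)
  flip-sign = solve-∀
  term : ∀ j → laplaceTerm N j ≡ - laplaceTerm M (adjSwap i j)
  term j with adjSwapView i j
  ... | left = begin
    sgn (toℕ (inject₁ i)) * N zero (inject₁ i) * det (submatrix N (inject₁ i))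
      ≡⟨ cong₂ (λ s m → sgn s * m * det (submatrix N (inject₁ i))) (toℕ-inject₁ i) (trans (N≈M zero _) (cong (M zero) (adjSwap-inject₁ i))) ⟩
    sgn (toℕ i) * M zero (suc i) * det (submatrix N (inject₁ i))
      ≡⟨ cong (sgn (toℕ i) * M zero (suc i) *_) (det-cong λ r c → trans (N≈M (suc r) _) (cong (M (suc r)) (adjSwap-punchIn-inject₁ i c))) ⟩
    sgn (toℕ i) * M zero (suc i) * det (submatrix M (suc i))
      ≡⟨ flip-sign (sgn (toℕ i)) (M zero (suc i)) (det (submatrix M (suc i))) ⟩
    - laplaceTerm M (suc i)
      ≡⟨ cong (λ j → - laplaceTerm M j) (adjSwap-inject₁ i) ⟨
    - laplaceTerm M (adjSwap i (inject₁ i))  ∎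
  ... | right = begin
    - sgn (toℕ i) * N zero (suc i) * det (submatrix N (suc i))
      ≡⟨ cong₂ (λ s m → - sgn s * m * det (submatrix N (suc i))) (sym (toℕ-inject₁ i)) (trans (N≈M zero _) (cong (M zero) (adjSwap-suc i))) ⟩
    - sgn (toℕ (inject₁ i)) * M zero (inject₁ i) * det (submatrix N (suc i))
      ≡⟨ cong (- sgn (toℕ (inject₁ i)) * M zero (inject₁ i) *_) (det-cong λ r c → trans (N≈M (suc r) _) (cong (M (suc r)) (adjSwap-punchIn-suc i c))) ⟩
    - sgn (toℕ (inject₁ i)) * M zero (inject₁ i) * det (submatrix M (inject₁ i))
      ≡⟨ negate-first (sgn (toℕ (inject₁ i))) (M zero (inject₁ i)) (det (submatrix M (inject₁ i))) ⟩
    - laplaceTerm M (inject₁ i)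
      ≡⟨ cong (λ j → - laplaceTerm M j) (adjSwap-suc i) ⟨
    - laplaceTerm M (adjSwap i (suc i))  ∎
    where
    negate-first : ∀ s m d → - s * m * d ≡ - (s * m * d)
    negate-first = solve-∀
  ... | other i′ fixed commutes = begin
    sgn (toℕ j) * N zero j * det (submatrix N j)
      ≡⟨ cong₂ (λ m d → sgn (toℕ j) * m * d) (trans (N≈M zero j) (cong (M zero) fixed))
               (det-swap-adjacent-columns i′ (submatrix M j) (submatrix N j) λ r c → trans (N≈M (suc r) _) (cong (M (suc r)) (commutes c))) ⟩
    sgn (toℕ j) * M zero j * - det (submatrix M j)
      ≡⟨ negate-last (sgn (toℕ j)) (M zero j) (det (submatrix M j)) ⟩
    - laplaceTerm M j
      ≡⟨ cong (λ j → - laplaceTerm M j) fixed ⟨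
    - laplaceTerm M (adjSwap i j)  ∎
    where
    negate-last : ∀ s m d → s * m * - d ≡ - (s * m * d)
    negate-last = solve-∀

-- In the double Laplace expansion along the first two rows, the columns used by rows 0 and 1 are
-- j and punchIn j l; exchanging the two rows corresponds to the reindexing (j , l) ↦ (punchIn j l , punchBack j l).
punchBack : ∀ {n} → Fin (suc (suc n)) → Fin (suc n) → Fin (suc n)
punchBack zero            l       = zero
punchBack (suc j)         zero    = j
punchBack {suc n} (suc j) (suc l) = suc (punchBack j l)

punchIn-punchBack : ∀ {n} (j : Fin (suc (suc n))) l → punchIn (punchIn j l) (punchBack j l) ≡ j
punchIn-punchBack zero            l       = refl
punchIn-punchBack (suc j)         zero    = refl
punchIn-punchBack {suc n} (suc j) (suc l) = cong suc (punchIn-punchBack j l)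

punchIn²-punchBack : ∀ {n} (j : Fin (suc (suc n))) l c →
  punchIn j (punchIn l c) ≡ punchIn (punchIn j l) (punchIn (punchBack j l) c)
punchIn²-punchBack zero            l       c       = refl
punchIn²-punchBack (suc j)         zero    c       = refl
punchIn²-punchBack {suc n} (suc j) (suc l) zero    = refl
punchIn²-punchBack {suc n} (suc j) (suc l) (suc c) = cong suc (punchIn²-punchBack j l c)

sgn-punchBack : ∀ {n} (j : Fin (suc (suc n))) l →
  sgn (toℕ (punchIn j l)) * sgn (toℕ (punchBack j l)) ≡ - (sgn (toℕ j) * sgn (toℕ l))
sgn-punchBack zero            l       = ring (sgn (toℕ l))
  where
  ring : ∀ s → - s * 1ℤ ≡ - (1ℤ * s)
  ring = solve-∀
sgn-punchBack (suc j)         zero    = ring (sgn (toℕ j))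
  where
  ring : ∀ s → 1ℤ * s ≡ - (- s * 1ℤ)
  ring = solve-∀
sgn-punchBack {suc n} (suc j) (suc l) = begin
  - sgn (toℕ (punchIn j l)) * - sgn (toℕ (punchBack j l))  ≡⟨ ring₁ (sgn (toℕ (punchIn j l))) _ ⟩
  sgn (toℕ (punchIn j l)) * sgn (toℕ (punchBack j l))      ≡⟨ sgn-punchBack j l ⟩
  - (sgn (toℕ j) * sgn (toℕ l))                            ≡⟨ ring₂ (sgn (toℕ j)) _ ⟩
  - (- sgn (toℕ j) * - sgn (toℕ l))                        ∎
  where
  ring₁ : ∀ a b → - a * - b ≡ a * b
  ring₁ = solve-∀
  ring₂ : ∀ a b → - (a * b) ≡ - (- a * - b)
  ring₂ = solve-∀

sumFin-punchBack : ∀ {n} (F : Fin (suc (suc n)) → Fin (suc n) → ℤ) →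
  sumFin (λ j → sumFin (F j)) ≡ sumFin (λ j → sumFin (λ l → F (punchIn j l) (punchBack j l)))
sumFin-punchBack {zero} F = ring (F zero zero) (F (suc zero) zero)
  where
  ring : ∀ a b → (a + 0ℤ) + ((b + 0ℤ) + 0ℤ) ≡ (b + 0ℤ) + ((a + 0ℤ) + 0ℤ)
  ring = solve-∀
sumFin-punchBack {suc n} F = begin
  sumFin (F zero) + sumFin (λ j → F (suc j) zero + sumFin (λ l → F (suc j) (suc l)))
    ≡⟨ cong (sumFin (F zero) +_) (sumFin-+ (λ j → F (suc j) zero) (λ j → sumFin (λ l → F (suc j) (suc l)))) ⟩
  sumFin (F zero) + (sumFin (λ j → F (suc j) zero) + sumFin (λ j → sumFin (λ l → F (suc j) (suc l))))
    ≡⟨ cong (λ s → sumFin (F zero) + (sumFin (λ j → F (suc j) zero) + s)) (sumFin-punchBack (λ j l → F (suc j) (suc l))) ⟩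
  sumFin (F zero) + (sumFin (λ j → F (suc j) zero) + rest)
    ≡⟨ ring (sumFin (F zero)) (sumFin (λ j → F (suc j) zero)) rest ⟩
  sumFin (λ j → F (suc j) zero) + (sumFin (F zero) + rest)
    ≡⟨ cong (sumFin (λ j → F (suc j) zero) +_) (sumFin-+ (F zero) (λ j → sumFin (λ l → F (suc (punchIn j l)) (suc (punchBack j l))))) ⟨
  sumFin (λ j → F (suc j) zero) + sumFin (λ j → F zero j + sumFin (λ l → F (suc (punchIn j l)) (suc (punchBack j l))))  ∎
  where
  rest = sumFin (λ j → sumFin (λ l → F (suc (punchIn j l)) (suc (punchBack j l))))
  ring : ∀ a b c → a + (b + c) ≡ b + (a + c)
  ring = solve-∀

expansionTerm₂ : ∀ {n} → Mat (suc (suc n)) (suc (suc n)) → Fin (suc (suc n)) → Fin (suc n) → ℤ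
expansionTerm₂ M j l = (sgn (toℕ j) * M zero j) * (sgn (toℕ l) * M (suc zero) (punchIn j l) * det (λ r c → M (suc (suc r)) (punchIn j (punchIn l c))))

det-expand₂ : ∀ {n} (M : Mat (suc (suc n)) (suc (suc n))) → det M ≡ sumFin (λ j → sumFin (expansionTerm₂ M j))
det-expand₂ M = sumFin-cong λ j → sym (sumFin-*ˡ (sgn (toℕ j) * M zero j) (λ l → sgn (toℕ l) * M (suc zero) (punchIn j l) * det (λ r c → M (suc (suc r)) (punchIn j (punchIn l c)))))

det-swap-first-rows : ∀ {n} (M N : Mat (suc (suc n)) (suc (suc n))) →
  (∀ c → N zero c ≡ M (suc zero) c) → (∀ c → N (suc zero) c ≡ M zero c) →
  (∀ r c → N (suc (suc r)) c ≡ M (suc (suc r)) c) → det N ≡ - det M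
det-swap-first-rows M N N₀≈M₁ N₁≈M₀ N≈M = begin
  det N                                                                       ≡⟨ det-expand₂ N ⟩
  sumFin (λ j → sumFin (expansionTerm₂ N j))                                  ≡⟨ sumFin-cong (λ j → sumFin-cong (term j)) ⟩
  sumFin (λ j → sumFin (λ l → - expansionTerm₂ M (punchIn j l) (punchBack j l))) ≡⟨ sumFin-cong (λ j → sumFin-neg (λ l → expansionTerm₂ M (punchIn j l) (punchBack j l))) ⟩
  sumFin (λ j → - sumFin (λ l → expansionTerm₂ M (punchIn j l) (punchBack j l))) ≡⟨ sumFin-neg (λ j → sumFin (λ l → expansionTerm₂ M (punchIn j l) (punchBack j l))) ⟩
  - sumFin (λ j → sumFin (λ l → expansionTerm₂ M (punchIn j l) (punchBack j l))) ≡⟨ cong -_ (sumFin-punchBack (expansionTerm₂ M)) ⟨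
  - sumFin (λ j → sumFin (expansionTerm₂ M j))                                ≡⟨ cong -_ (det-expand₂ M) ⟨
  - det M                                                                     ∎
  where
  term : ∀ j l → expansionTerm₂ N j l ≡ - expansionTerm₂ M (punchIn j l) (punchBack j l)
  term j l = begin
    (sj * N zero j) * (sl * x * Δ)                    ≡⟨ ring₁ sj sl (N zero j) x Δ ⟩
    - (- (sj * sl) * (x * N zero j * Δ))              ≡⟨ cong (λ s → - (s * (x * N zero j * Δ))) (sgn-punchBack j l) ⟨
    - ((sj′ * sl′) * (x * N zero j * Δ))              ≡⟨ cong -_ (ring₂ sj′ sl′ x (N zero j) Δ) ⟩
    - ((sj′ * x) * (sl′ * N zero j * Δ))              ≡⟨ cong -_ (cong₂ (λ a b → (sj′ * a) * (sl′ * b * Δ)) M₀ M₁) ⟩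
    - ((sj′ * M zero j′) * (sl′ * M (suc zero) (punchIn j′ l′) * Δ))
      ≡⟨ cong (λ d → - ((sj′ * M zero j′) * (sl′ * M (suc zero) (punchIn j′ l′) * d))) Δ≡ ⟩
    - expansionTerm₂ M j′ l′                          ∎
    where
    j′ = punchIn j l
    l′ = punchBack j l
    sj = sgn (toℕ j)
    sl = sgn (toℕ l)
    sj′ = sgn (toℕ j′)
    sl′ = sgn (toℕ l′)
    x = N (suc zero) (punchIn j l)
    Δ = det (λ r c → N (suc (suc r)) (punchIn j (punchIn l c)))
    M₀ : x ≡ M zero j′
    M₀ = N₁≈M₀ j′
    M₁ : N zero j ≡ M (suc zero) (punchIn j′ l′)
    M₁ = trans (N₀≈M₁ j) (cong (M (suc zero)) (sym (punchIn-punchBack j l)))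
    Δ≡ : Δ ≡ det (λ r c → M (suc (suc r)) (punchIn j′ (punchIn l′ c)))
    Δ≡ = det-cong λ r c → trans (N≈M r _) (cong (M (suc (suc r))) (punchIn²-punchBack j l c))
    ring₁ : ∀ a b u v d → (a * u) * (b * v * d) ≡ - (- (a * b) * (v * u * d))
    ring₁ = solve-∀
    ring₂ : ∀ a b u v d → (a * b) * (u * v * d) ≡ (a * u) * (b * v * d)
    ring₂ = solve-∀

det-swap-adjacent-rows : ∀ {k} (i : Fin k) (M N : Mat (suc k) (suc k)) →
  (∀ r c → N r c ≡ M (adjSwap i r) c) → det N ≡ - det M
det-swap-adjacent-rows {suc k} zero M N N≈M = det-swap-first-rows M N (N≈M zero) (N≈M (suc zero)) (λ r → N≈M (suc (suc r)))
det-swap-adjacent-rows {suc k} (suc i) M N N≈M = begin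
  sumFin (laplaceTerm N)          ≡⟨ sumFin-cong term ⟩
  sumFin (λ j → - laplaceTerm M j) ≡⟨ sumFin-neg (laplaceTerm M) ⟩
  - sumFin (laplaceTerm M)        ∎
  where
  negate-last : ∀ s m d → s * m * - d ≡ - (s * m * d)
  negate-last = solve-∀
  term : ∀ j → laplaceTerm N j ≡ - laplaceTerm M j
  term j = trans (cong₂ (λ m d → sgn (toℕ j) * m * d) (N≈M zero j)
                        (det-swap-adjacent-rows i (submatrix M j) (submatrix N j) (λ r c → N≈M (suc r) _)))
                 (negate-last (sgn (toℕ j)) (M zero j) (det (submatrix M j)))

injective⇒surjective : ∀ {n} {ρ : Fin n → Fin n} → Injective _≡_ _≡_ ρ → ∀ y → ∃ λ x → ρ x ≡ y
injective⇒surjective {n} {ρ} ρ-inj y with any? (λ x → ρ x ≟ᶠ y)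
... | yes found = found
injective⇒surjective {suc n} {ρ} ρ-inj y | no missed =
  ⊥-elim (ℕ.<-irrefl (cong toℕ (ρ-inj (punchOut-injective (avoids i) (avoids j) ρi≡ρj))) i<j)
  where
  avoids : ∀ x → y ≢ ρ x
  avoids x y≡ρx = missed (x , sym y≡ρx)
  collision = pigeonhole (ℕ.n<1+n n) (λ x → punchOut (avoids x))
  i = proj₁ collision
  j = proj₁ (proj₂ collision)
  i<j = proj₁ (proj₂ (proj₂ collision))
  ρi≡ρj = proj₂ (proj₂ (proj₂ collision))

data Sortable {n} : (Fin (suc n) → Fin (suc n)) → Set where
  sorted  : ∀ {ρ} → ρ ≗ id → Sortable ρ
  swapped : ∀ {ρ} i → Sortable (ρ ∘ adjSwap i) → Sortable ρ

module _ {n : ℕ} where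

  private
    Fixes : ℕ → (Fin (suc n) → Fin (suc n)) → Set
    Fixes k ρ = ∀ i → toℕ i ℕ.< k → ρ i ≡ i

    bubble : ∀ e {k} (k<n : k ℕ.< suc n) {ρ} p → toℕ p ≡ k ℕ.+ e → ρ p ≡ fromℕ< k<n →
             Injective _≡_ _≡_ ρ → Fixes k ρ →
             (∀ {σ} → Injective _≡_ _≡_ σ → Fixes (suc k) σ → Sortable σ) → Sortable ρ
    bubble zero {k} k<n {ρ} p p≡k ρp≡k ρ-inj fixes sort = sort ρ-inj fixes′
      where
      p≡k′ : p ≡ fromℕ< k<n
      p≡k′ = toℕ-injective (trans p≡k (trans (ℕ.+-identityʳ k) (sym (toℕ-fromℕ< k<n))))
      fixes′ : Fixes (suc k) ρ
      fixes′ i i<k+1 with ℕ.m≤n⇒m<n∨m≡n (ℕ.≤-pred i<k+1)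
      ... | inj₁ i<k = fixes i i<k
      ... | inj₂ i≡k = let i≡p = trans (toℕ-injective (trans i≡k (sym (toℕ-fromℕ< k<n)))) (sym p≡k′)
                       in trans (cong ρ i≡p) (trans ρp≡k (trans (sym p≡k′) (sym i≡p)))
    bubble (suc e) k<n zero p≡k+e+1 ρp≡k ρ-inj fixes sort = ⊥-elim (ℕ.0≢1+n (trans p≡k+e+1 (ℕ.+-suc _ e)))
    bubble (suc e) {k} k<n {ρ} (suc q) p≡k+e+1 ρp≡k ρ-inj fixes sort =
      swapped q (bubble e k<n (inject₁ q) q≡k+e (trans (cong ρ (adjSwap-inject₁ q)) ρp≡k) σ-inj σ-fixes sort)
      where
      q≡k+e : toℕ (inject₁ q) ≡ k ℕ.+ e
      q≡k+e = trans (toℕ-inject₁ q) (ℕ.suc-injective (trans p≡k+e+1 (ℕ.+-suc k e)))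
      below⇒≢ : ∀ {i j : Fin (suc n)} → toℕ i ℕ.< k → k ℕ.≤ toℕ j → i ≢ j
      below⇒≢ i<k k≤j refl = ℕ.<-irrefl refl (ℕ.<-≤-trans i<k k≤j)
      σ-inj : Injective _≡_ _≡_ (ρ ∘ adjSwap q)
      σ-inj {a} {b} eq = trans (sym (adjSwap-involutive q a)) (trans (cong (adjSwap q) (ρ-inj eq)) (adjSwap-involutive q b))
      σ-fixes : Fixes k (ρ ∘ adjSwap q)
      σ-fixes i i<k = trans (cong ρ (adjSwap-fix q (below⇒≢ i<k (subst (k ℕ.≤_) (sym q≡k+e) (ℕ.m≤m+n k e)))
                                                    (below⇒≢ i<k (subst (k ℕ.≤_) (sym p≡k+e+1) (ℕ.m≤m+n k (suc e))))))
                            (fixes i i<k)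

    sortFrom : ∀ d k → k ℕ.+ d ≡ suc n → ∀ {ρ} → Injective _≡_ _≡_ ρ → Fixes k ρ → Sortable ρ
    sortFrom zero k k≡n ρ-inj fixes =
      sorted λ i → fixes i (subst (toℕ i ℕ.<_) (sym (trans (sym (ℕ.+-identityʳ k)) k≡n)) (toℕ<n i))
    sortFrom (suc d) k k+d+1≡n {ρ} ρ-inj fixes =
      bubble (toℕ p ℕ.∸ k) k<n p (sym (ℕ.m+[n∸m]≡n k≤p)) ρp≡k ρ-inj fixes
             (sortFrom d (suc k) (trans (sym (ℕ.+-suc k d)) k+d+1≡n))
      where
      k<n : k ℕ.< suc n
      k<n = subst (k ℕ.<_) k+d+1≡n (ℕ.m<m+n k (ℕ.s≤s ℕ.z≤n))
      p = proj₁ (injective⇒surjective ρ-inj (fromℕ< k<n))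
      ρp≡k = proj₂ (injective⇒surjective ρ-inj (fromℕ< k<n))
      k≤p : k ℕ.≤ toℕ p
      k≤p = ℕ.≮⇒≥ λ p<k → ℕ.<-irrefl (trans (cong toℕ (trans (sym (fixes p p<k)) ρp≡k)) (toℕ-fromℕ< k<n)) p<k

  injective⇒sortable : ∀ {ρ : Fin (suc n) → Fin (suc n)} → Injective _≡_ _≡_ ρ → Sortable ρ
  injective⇒sortable ρ-inj = sortFrom (suc n) zero refl ρ-inj λ i ()

module Alternating {n m} (Φ : (Fin (suc n) → Fin m → ℤ) → ℤ)
  (Φ-cong : ∀ {v w} → (∀ a j → v a j ≡ w a j) → Φ v ≡ Φ w)
  (Φ-adjSwap : ∀ i v → Φ (v ∘ adjSwap i) ≡ - Φ v) where

  private
    at : ∀ (v : Fin (suc n) → Fin m → ℤ) j {a b} → a ≡ b → v a j ≡ v b j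
    at v j = cong (λ a → v a j)

  repeated-adjacent : ∀ v i → (∀ j → v (inject₁ i) j ≡ v (suc i) j) → Φ v ≡ 0ℤ
  repeated-adjacent v i eq = x≡-x⇒x≡0 (trans (sym (Φ-cong swap-fixes)) (Φ-adjSwap i v))
    where
    swap-fixes : ∀ c j → v (adjSwap i c) j ≡ v c j
    swap-fixes c j with c ≟ᶠ inject₁ i | c ≟ᶠ suc i
    ... | yes refl | _        = trans (at v j (adjSwap-inject₁ i)) (sym (eq j))
    ... | no _     | yes refl = trans (at v j (adjSwap-suc i)) (eq j)
    ... | no c≢i   | no c≢i+1 = at v j (adjSwap-fix i c≢i c≢i+1)

  private
    repeated-apart : ∀ d v a b → toℕ b ≡ suc (toℕ a ℕ.+ d) → (∀ j → v a j ≡ v b j) → Φ v ≡ 0ℤ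
    repeated-apart d v a zero () va≡vb
    repeated-apart zero v a (suc i) b≡a+1 va≡vb =
      repeated-adjacent v i λ j → trans (at v j (sym a≡i)) (va≡vb j)
      where
      a≡i : a ≡ inject₁ i
      a≡i = toℕ-injective (trans (sym (ℕ.+-identityʳ (toℕ a))) (trans (sym (ℕ.suc-injective b≡a+1)) (sym (toℕ-inject₁ i))))
    repeated-apart (suc d) v a (suc i) b≡a+d+2 va≡vb =
      trans (sym (neg-involutive (Φ v))) (cong -_ (trans (sym (Φ-adjSwap i v)) Φw≡0))
      where
      i≡a+d+1 : toℕ (inject₁ i) ≡ suc (toℕ a ℕ.+ d)
      i≡a+d+1 = trans (toℕ-inject₁ i) (trans (ℕ.suc-injective b≡a+d+2) (ℕ.+-suc (toℕ a) d))
      a≢i : a ≢ inject₁ i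
      a≢i a≡i = ℕ.m≢1+m+n (toℕ a) (trans (cong toℕ a≡i) i≡a+d+1)
      a≢i+1 : a ≢ suc i
      a≢i+1 a≡i+1 = ℕ.m≢1+m+n (toℕ a) (trans (cong toℕ a≡i+1) b≡a+d+2)
      Φw≡0 : Φ (v ∘ adjSwap i) ≡ 0ℤ
      Φw≡0 = repeated-apart d (v ∘ adjSwap i) a (inject₁ i) i≡a+d+1 λ j →
               trans (at v j (adjSwap-fix i a≢i a≢i+1)) (trans (va≡vb j) (at v j (sym (adjSwap-inject₁ i))))

  repeated : ∀ v {a b} → a ≢ b → (∀ j → v a j ≡ v b j) → Φ v ≡ 0ℤ
  repeated v {a} {b} a≢b va≡vb with ℕ.<-cmp (toℕ a) (toℕ b)
  ... | tri< a<b _ _ = repeated-apart (toℕ b ℕ.∸ suc (toℕ a)) v a b (sym (ℕ.m+[n∸m]≡n a<b)) va≡vb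
  ... | tri≈ _ a≡b _ = ⊥-elim (a≢b (toℕ-injective a≡b))
  ... | tri> _ _ b<a = repeated-apart (toℕ a ℕ.∸ suc (toℕ b)) v b a (sym (ℕ.m+[n∸m]≡n b<a)) (sym ∘ va≡vb)

  ∣Φ∣-sortable : ∀ {ρ} → Sortable ρ → ∀ v → ℤ.∣ Φ (v ∘ ρ) ∣ ≡ ℤ.∣ Φ v ∣
  ∣Φ∣-sortable (sorted ρ≗id) v = cong ℤ.∣_∣ (Φ-cong λ a j → at v j (ρ≗id a))
  ∣Φ∣-sortable {ρ} (swapped i s) v = begin
    ℤ.∣ Φ (v ∘ ρ) ∣                  ≡⟨ ∣-i∣≡∣i∣ (Φ (v ∘ ρ)) ⟨
    ℤ.∣ - Φ (v ∘ ρ) ∣                ≡⟨ cong ℤ.∣_∣ (Φ-adjSwap i (v ∘ ρ)) ⟨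
    ℤ.∣ Φ (v ∘ ρ ∘ adjSwap i) ∣      ≡⟨ ∣Φ∣-sortable s v ⟩
    ℤ.∣ Φ v ∣                        ∎

  ∣Φ∣-permute : ∀ {ρ} → Injective _≡_ _≡_ ρ → ∀ v → ℤ.∣ Φ (v ∘ ρ) ∣ ≡ ℤ.∣ Φ v ∣
  ∣Φ∣-permute ρ-inj = ∣Φ∣-sortable (injective⇒sortable ρ-inj)

det-repeated-column : ∀ {k} (M : Mat k k) {a b} → a ≢ b → (∀ r → M r a ≡ M r b) → det M ≡ 0ℤ
det-repeated-column {suc k} M = Alternating.repeated (λ v → det (λ r c → v c r))
  (λ v≈w → det-cong λ r c → v≈w c r) (λ i v → det-swap-adjacent-columns i (λ r c → v c r) _ λ r c → refl) (λ c r → M r c)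

det-repeated-row : ∀ {k} (M : Mat k k) {a b} → a ≢ b → (∀ c → M a c ≡ M b c) → det M ≡ 0ℤ
det-repeated-row {suc k} M = Alternating.repeated det det-cong (λ i v → det-swap-adjacent-rows i v _ λ r c → refl) M

∣det∣-permute-rows : ∀ {k} (M : Mat k k) {ρ : Fin k → Fin k} → Injective _≡_ _≡_ ρ → ℤ.∣ det (M ∘ ρ) ∣ ≡ ℤ.∣ det M ∣
∣det∣-permute-rows {zero} M ρ-inj = refl
∣det∣-permute-rows {suc k} M ρ-inj = Alternating.∣Φ∣-permute det det-cong (λ i v → det-swap-adjacent-rows i v _ λ r c → refl) ρ-inj M

setColumn : ∀ {k} → Mat k k → Fin k → (Fin k → ℤ) → Mat k k
setColumn M a w r c with c ≟ᶠ a
... | yes _ = w r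
... | no _  = M r c

setColumn-at : ∀ {k} (M : Mat k k) a w r → setColumn M a w r a ≡ w r
setColumn-at M a w r with a ≟ᶠ a
... | yes _ = refl
... | no a≢a = ⊥-elim (a≢a refl)

setColumn-off : ∀ {k} (M : Mat k k) {a} w r {c} → c ≢ a → setColumn M a w r c ≡ M r c
setColumn-off M {a} w r {c} c≢a with c ≟ᶠ a
... | yes c≡a = ⊥-elim (c≢a c≡a)
... | no _ = refl

det-zero-column : ∀ {k} (M : Mat k k) a → (∀ r → M r a ≡ 0ℤ) → det M ≡ 0ℤ
det-zero-column M a Mₐ≡0 = det-linear-column a {M} {M} 0ℤ 0ℤ (λ _ _ _ → refl) (λ _ _ _ → refl) Mₐ≡0

det-setColumn-sum : ∀ {k t} (M : Mat k k) a (μ : Fin t → ℤ) (v : Fin t → Fin k → ℤ) →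
  det (setColumn M a (λ r → sumFin (λ b → μ b * v b r))) ≡ sumFin (λ b → μ b * det (setColumn M a (v b)))
det-setColumn-sum {t = zero} M a μ v = det-zero-column _ a (setColumn-at M a _)
det-setColumn-sum {t = suc t} M a μ v = begin
  det (setColumn M a (λ r → sumFin (λ b → μ b * v b r)))
    ≡⟨ det-linear-column a (μ zero) 1ℤ (agree (v zero)) (agree rest) split ⟩
  μ zero * det (setColumn M a (v zero)) + 1ℤ * det (setColumn M a rest)
    ≡⟨ cong (μ zero * det (setColumn M a (v zero)) +_) (trans (*-identityˡ _) (det-setColumn-sum M a (μ ∘ suc) (v ∘ suc))) ⟩
  μ zero * det (setColumn M a (v zero)) + sumFin (λ b → μ (suc b) * det (setColumn M a (v (suc b))))  ∎
  where
  rest : Fin _ → ℤ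
  rest r = sumFin (λ b → μ (suc b) * v (suc b) r)
  agree : ∀ w r c → c ≢ a → setColumn M a w r c ≡ setColumn M a (λ r → sumFin (λ b → μ b * v b r)) r c
  agree w r c c≢a = trans (setColumn-off M w r c≢a) (sym (setColumn-off M _ r c≢a))
  split : ∀ r → setColumn M a (λ r → sumFin (λ b → μ b * v b r)) r a
                ≡ μ zero * setColumn M a (v zero) r a + 1ℤ * setColumn M a rest r a
  split r = begin
    setColumn M a (λ r → sumFin (λ b → μ b * v b r)) r a  ≡⟨ setColumn-at M a _ r ⟩
    μ zero * v zero r + rest r                            ≡⟨ cong₂ (λ x y → μ zero * x + y) (setColumn-at M a _ r) (*-identityˡ _) ⟨
    μ zero * setColumn M a (v zero) r a + 1ℤ * rest r     ≡⟨ cong (λ y → μ zero * setColumn M a (v zero) r a + 1ℤ * y) (setColumn-at M a rest r) ⟨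
    μ zero * setColumn M a (v zero) r a + 1ℤ * setColumn M a rest r a  ∎

-- Linear independence of columns

InKernel : ∀ {m t} → Mat m t → (Fin t → ℤ) → Set
InKernel N μ = ∀ i → sumFin (λ c → N i c * μ c) ≡ 0ℤ

IndependentColumns : ∀ {m t} → Mat m t → Set
IndependentColumns N = ∀ μ → InKernel N μ → ∀ c → μ c ≡ 0ℤ

IndependentColumns-cong : ∀ {m t} {N N′ : Mat m t} → IndependentColumns N → (∀ i a → N i a ≡ N′ i a) → IndependentColumns N′
IndependentColumns-cong N-ind N≈N′ μ N′μ≡0 = N-ind μ λ i → trans (sumFin-cong λ a → cong (_* μ a) (N≈N′ i a)) (N′μ≡0 i)

-- Cramer: μ a · det M is the determinant of M with column a replaced by M μ.
det≢0⇒independent : ∀ {k} (M : Mat k k) → det M ≢ 0ℤ → IndependentColumns M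
det≢0⇒independent M det≢0 μ Mμ≡0 a with i*j≡0⇒i≡0∨j≡0 (μ a) μₐdet≡0
  where
  μₐdet≡0 : μ a * det M ≡ 0ℤ
  μₐdet≡0 = begin
    μ a * det M                                                   ≡⟨ cong (μ a *_) (det-cong λ r c → setColumn-restore r c) ⟨
    μ a * det (setColumn M a (λ r → M r a))                       ≡⟨ sumFin-single (λ b → μ b * det (setColumn M a (λ r → M r b))) a others ⟨
    sumFin (λ b → μ b * det (setColumn M a (λ r → M r b)))        ≡⟨ det-setColumn-sum M a μ (λ b r → M r b) ⟨
    det (setColumn M a (λ r → sumFin (λ b → μ b * M r b)))        ≡⟨ det-zero-column _ a (λ r → trans (setColumn-at M a _ r) (trans (sumFin-cong (λ b → *-comm (μ b) (M r b))) (Mμ≡0 r))) ⟩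
    0ℤ                                                            ∎
    where
    setColumn-restore : ∀ r c → setColumn M a (λ r → M r a) r c ≡ M r c
    setColumn-restore r c with c ≟ᶠ a
    ... | yes refl = refl
    ... | no _ = refl
    others : ∀ b → b ≢ a → μ b * det (setColumn M a (λ r → M r b)) ≡ 0ℤ
    others b b≢a = trans (cong (μ b *_) (det-repeated-column _ (b≢a ∘ sym) λ r → trans (setColumn-at M a _ r) (sym (setColumn-off M _ r b≢a)))) (*-zeroʳ (μ b))
... | inj₁ μₐ≡0 = μₐ≡0
... | inj₂ det≡0 = ⊥-elim (det≢0 det≡0)

nonzero-minor⇒independent : ∀ {m t} (N : Mat m t) (R : Fin t → Fin m) → det (N ∘ R) ≢ 0ℤ → IndependentColumns N
nonzero-minor⇒independent N R minor≢0 μ Nμ≡0 = det≢0⇒independent (N ∘ R) minor≢0 μ (Nμ≡0 ∘ R)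

-- The Laplace expansion of the minor on rows (i ∷ R) along its first row is the i-th entry of N · cofactors N R.
cofactors : ∀ {m t} → Mat m (suc t) → (Fin t → Fin m) → Fin (suc t) → ℤ
cofactors N R j = sgn (toℕ j) * det (λ r c → N (R r) (punchIn j c))

cofactors-kernel : ∀ {m t} (N : Mat m (suc t)) → (∀ R → det (N ∘ R) ≡ 0ℤ) → ∀ R → InKernel N (cofactors N R)
cofactors-kernel N minors≡0 R i = trans (sumFin-cong λ j → ring (N i j) (sgn (toℕ j)) (det (λ r c → N (R r) (punchIn j c)))) (minors≡0 (i ∷ R))
  where
  ring : ∀ n s d → n * (s * d) ≡ s * n * d
  ring = solve-∀

minors-vanish⇒dependent : ∀ {m} t (N : Mat m t) → (∀ R → det (N ∘ R) ≡ 0ℤ) → ¬ IndependentColumns N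
minors-vanish⇒dependent zero N minors≡0 _ with minors≡0 (λ ())
... | ()
minors-vanish⇒dependent {m} (suc t) N minors≡0 N-ind = minors-vanish⇒dependent t N′ N′-minors≡0 N′-ind
  where
  N′ : Mat m t
  N′ i c = N i (suc c)
  N′-ind : IndependentColumns N′
  N′-ind μ N′μ≡0 c = N-ind (0ℤ ∷ μ) (λ i → trans (cong (_+ sumFin (λ c → N′ i c * μ c)) (*-zeroʳ (N i zero))) (trans (+-identityˡ _) (N′μ≡0 i))) (suc c)
  N′-minors≡0 : ∀ R → det (N′ ∘ R) ≡ 0ℤ
  N′-minors≡0 R = decidable-stable (det (N′ ∘ R) ≟ 0ℤ) λ minor≢0 →
    minor≢0 (trans (sym (*-identityˡ _)) (N-ind (cofactors N R) (cofactors-kernel N minors≡0 R) zero))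

independent⇒¬¬nonzero-minor : ∀ {m t} (N : Mat m t) → IndependentColumns N → ¬ ¬ ∃ λ R → det (N ∘ R) ≢ 0ℤ
independent⇒¬¬nonzero-minor {t = t} N N-ind none =
  minors-vanish⇒dependent t N (λ R → decidable-stable (det (N ∘ R) ≟ 0ℤ) λ minor≢0 → none (R , minor≢0)) N-ind

dependent-extension : ∀ {m t} (N : Mat m (suc t)) → IndependentColumns (λ i c → N i (suc c)) → ¬ IndependentColumns N →
  ¬ ¬ ∃ λ μ → μ zero ≢ 0ℤ × InKernel N μ
dependent-extension N N′-ind N-dep none = independent⇒¬¬nonzero-minor (λ i c → N i (suc c)) N′-ind λ (R , minor≢0) →
  none (cofactors N R , (λ μ₀≡0 → minor≢0 (trans (sym (*-identityˡ _)) μ₀≡0)) , cofactors-kernel N (minors≡0) R)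
  where
  minors≡0 : ∀ R → det (N ∘ R) ≡ 0ℤ
  minors≡0 R = decidable-stable (det (N ∘ R) ≟ 0ℤ) λ minor≢0 → N-dep (nonzero-minor⇒independent N R minor≢0)

-- More columns than rows are always dependent: every maximal minor repeats a row.
independent⇒≤rows : ∀ {m t} (N : Mat m t) → IndependentColumns N → t ℕ.≤ m
independent⇒≤rows {m} {t} N N-ind = ℕ.≮⇒≥ λ m<t → minors-vanish⇒dependent t N (repeats m<t) N-ind
  where
  repeats : m ℕ.< t → ∀ R → det (N ∘ R) ≡ 0ℤ
  repeats m<t R = let (i , j , i<j , Ri≡Rj) = pigeonhole m<t R in det-repeated-row (N ∘ R) (<⇒≢ i<j) λ c → cong (λ r → N r c) Ri≡Rj

columns : ∀ {m k s} → Mat m k → (Fin s → Fin k) → Mat m s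
columns A κ i a = A i (κ a)

δ : ∀ {k} → Fin k → Fin k → ℤ
δ x y with x ≟ᶠ y
... | yes _ = 1ℤ
... | no _ = 0ℤ

δ-≢ : ∀ {k} {x y : Fin k} → x ≢ y → δ x y ≡ 0ℤ
δ-≢ {x = x} {y} x≢y with x ≟ᶠ y
... | yes x≡y = ⊥-elim (x≢y x≡y)
... | no _ = refl

δ-refl : ∀ {k} (x : Fin k) → δ x x ≡ 1ℤ
δ-refl x with x ≟ᶠ x
... | yes _ = refl
... | no x≢x = ⊥-elim (x≢x refl)

pushforward : ∀ {s k} → (Fin s → Fin k) → (Fin s → ℤ) → Fin k → ℤ
pushforward κ μ j = sumFin (λ a → δ (κ a) j * μ a)

sumFin-pushforward : ∀ {s k} (κ : Fin s → Fin k) μ (w : Fin k → ℤ) →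
  sumFin (λ j → w j * pushforward κ μ j) ≡ sumFin (λ a → w (κ a) * μ a)
sumFin-pushforward κ μ w = begin
  sumFin (λ j → w j * pushforward κ μ j)                ≡⟨ sumFin-cong (λ j → sumFin-*ˡ (w j) (λ a → δ (κ a) j * μ a)) ⟨
  sumFin (λ j → sumFin (λ a → w j * (δ (κ a) j * μ a))) ≡⟨ sumFin-comm (λ j a → w j * (δ (κ a) j * μ a)) ⟩
  sumFin (λ a → sumFin (λ j → w j * (δ (κ a) j * μ a))) ≡⟨ sumFin-cong (λ a → trans (sumFin-single _ (κ a) (off a)) (at a)) ⟩
  sumFin (λ a → w (κ a) * μ a)                          ∎
  where
  off : ∀ a j → j ≢ κ a → w j * (δ (κ a) j * μ a) ≡ 0ℤ
  off a j j≢κa = trans (cong (λ d → w j * (d * μ a)) (δ-≢ (j≢κa ∘ sym))) (*-zeroʳ (w j))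
  at : ∀ a → w (κ a) * (δ (κ a) (κ a) * μ a) ≡ w (κ a) * μ a
  at a = trans (cong (λ d → w (κ a) * (d * μ a)) (δ-refl (κ a))) (cong (w (κ a) *_) (*-identityˡ (μ a)))

pushforward-image : ∀ {s k} {κ : Fin s → Fin k} μ → Injective _≡_ _≡_ κ → ∀ a → pushforward κ μ (κ a) ≡ μ a
pushforward-image {κ = κ} μ κ-inj a = begin
  sumFin (λ b → δ (κ b) (κ a) * μ b)  ≡⟨ sumFin-single _ a (λ b b≢a → cong (_* μ b) (δ-≢ (b≢a ∘ κ-inj))) ⟩
  δ (κ a) (κ a) * μ a                 ≡⟨ cong (_* μ a) (δ-refl (κ a)) ⟩
  1ℤ * μ a                            ≡⟨ *-identityˡ (μ a) ⟩
  μ a                                 ∎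

pushforward-outside : ∀ {s k} (κ : Fin s → Fin k) μ j → (∀ a → κ a ≡ j → μ a ≡ 0ℤ) → pushforward κ μ j ≡ 0ℤ
pushforward-outside κ μ j vanish = sumFin-zero term
  where
  term : ∀ a → δ (κ a) j * μ a ≡ 0ℤ
  term a with κ a ≟ᶠ j
  ... | yes κa≡j = cong (1ℤ *_) (vanish a κa≡j)
  ... | no _ = refl

ColIndep⇒independent : ∀ {m k s} (A : Mat m k) {Y} {κ : Fin s → Fin k} → Injective _≡_ _≡_ κ → (∀ a → κ a ∈ Y) →
  ColIndep A Y → IndependentColumns (columns A κ)
ColIndep⇒independent A {Y} {κ} κ-inj κ∈Y Y-ind μ Aκμ≡0 a =
  trans (sym (pushforward-image μ κ-inj a)) (Y-ind (pushforward κ μ) supported (λ i → trans (sumFin-pushforward κ μ (A i)) (Aκμ≡0 i)) (κ a))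
  where
  supported : ∀ j → j ∉ Y → pushforward κ μ j ≡ 0ℤ
  supported j j∉Y = pushforward-outside κ μ j λ a κa≡j → ⊥-elim (j∉Y (subst (_∈ Y) κa≡j (κ∈Y a)))

independent⇒ColIndep : ∀ {m k s} (A : Mat m k) {Y} {κ : Fin s → Fin k} → Injective _≡_ _≡_ κ →
  (∀ j → j ∈ Y → ∃ λ a → κ a ≡ j) → IndependentColumns (columns A κ) → ColIndep A Y
independent⇒ColIndep A {Y} {κ} κ-inj κ-onto Aκ-ind λ′ supported Aλ′≡0 j = trans (λ′≡push j) (pushforward-outside κ μ j λ a _ → μ≡0 a)
  where
  μ : _ → ℤ
  μ a = λ′ (κ a)
  λ′≡push : ∀ j → λ′ j ≡ pushforward κ μ j
  λ′≡push j with j ∈? Y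
  ... | yes j∈Y = let (a , κa≡j) = κ-onto j j∈Y in
    trans (cong λ′ (sym κa≡j)) (trans (sym (pushforward-image μ κ-inj a)) (cong (pushforward κ μ) κa≡j))
  ... | no j∉Y = trans (supported j j∉Y) (sym (pushforward-outside κ μ j λ a κa≡j → trans (cong λ′ κa≡j) (supported j j∉Y)))
  μ≡0 : ∀ a → μ a ≡ 0ℤ
  μ≡0 = Aκ-ind μ λ i → trans (sym (sumFin-pushforward κ μ (A i))) (trans (sumFin-cong (λ j → cong (A i j *_) (sym (λ′≡push j)))) (Aλ′≡0 i))

enumerate : ∀ {n} (E : Subset n) → Fin ∣ E ∣ → Fin n
enumerate (true Vec.∷ E) zero = zero
enumerate (true Vec.∷ E) (suc j) = suc (enumerate E j)
enumerate (false Vec.∷ E) j = suc (enumerate E j)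

enumerate-injective : ∀ {n} (E : Subset n) → Injective _≡_ _≡_ (enumerate E)
enumerate-injective (true Vec.∷ E) {zero} {zero} _ = refl
enumerate-injective (true Vec.∷ E) {suc i} {suc j} eq = cong suc (enumerate-injective E (Data.Fin.Properties.suc-injective eq))
enumerate-injective (false Vec.∷ E) eq = enumerate-injective E (Data.Fin.Properties.suc-injective eq)

enumerate-∈ : ∀ {n} (E : Subset n) j → enumerate E j ∈ E
enumerate-∈ (true Vec.∷ E) zero = here
enumerate-∈ (true Vec.∷ E) (suc j) = there (enumerate-∈ E j)
enumerate-∈ (false Vec.∷ E) j = there (enumerate-∈ E j)

enumerate-onto : ∀ {n} (E : Subset n) {x} → x ∈ E → ∃ λ j → enumerate E j ≡ x
enumerate-onto (true Vec.∷ E) here = zero , refl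
enumerate-onto (true Vec.∷ E) (there x∈E) = let (j , eq) = enumerate-onto E x∈E in suc j , cong suc eq
enumerate-onto (false Vec.∷ E) (there x∈E) = let (j , eq) = enumerate-onto E x∈E in j , cong suc eq

∣∣-injection : ∀ {k n} {S : Subset k} {X : Subset n} (h : Fin k → Fin n) → Injective _≡_ _≡_ h →
  (∀ {j} → j ∈ S → h j ∈ X) → ∣ S ∣ ℕ.≤ ∣ X ∣
∣∣-injection {S = S} {X} h h-inj h∈X = injective⇒≤ {f = index} λ {a} {b} eq →
  enumerate-injective S (h-inj (trans (sym (index-correct a)) (trans (cong (enumerate X) eq) (index-correct b))))
  where
  index : Fin ∣ S ∣ → Fin ∣ X ∣
  index a = proj₁ (enumerate-onto X (h∈X (enumerate-∈ S a)))
  index-correct : ∀ a → enumerate X (index a) ≡ h (enumerate S a)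
  index-correct a = proj₂ (enumerate-onto X (h∈X (enumerate-∈ S a)))

∣∣-take-drop : ∀ a {b} (X : Subset (a ℕ.+ b)) → ∣ X ∣ ≡ ∣ take a X ∣ ℕ.+ ∣ drop a X ∣
∣∣-take-drop zero X = refl
∣∣-take-drop (suc a) (true Vec.∷ X) = cong suc (∣∣-take-drop a X)
∣∣-take-drop (suc a) (false Vec.∷ X) = ∣∣-take-drop a X

image : ∀ {s n} → (Fin s → Fin n) → Subset n
image τ = tabulate λ x → does (any? λ a → τ a ≟ᶠ x)

image-∈ : ∀ {s n} (τ : Fin s → Fin n) a → τ a ∈ image τ
image-∈ τ a = lookup⇒[]= (τ a) (image τ) (trans (lookup∘tabulate _ (τ a)) (found (any? λ b → τ b ≟ᶠ τ a)))
  where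
  found : (d : Dec (∃ λ b → τ b ≡ τ a)) → does d ≡ true
  found (yes _) = refl
  found (no none) = ⊥-elim (none (a , refl))

image-onto : ∀ {s n} (τ : Fin s → Fin n) {x} → x ∈ image τ → ∃ λ a → τ a ≡ x
image-onto τ {x} x∈image with any? (λ a → τ a ≟ᶠ x) | trans (sym (lookup∘tabulate _ x)) ([]=⇒lookup x∈image)
... | yes found | _ = found
... | no _ | ()

lookup-ext : ∀ {A : Set} {n} {u v : Vec A n} → (∀ i → lookup u i ≡ lookup v i) → u ≡ v
lookup-ext {u = u} {v} u≗v = trans (sym (tabulate∘lookup u)) (trans (tabulate-cong u≗v) (tabulate∘lookup v))

module _ {A : Set} (a : ℕ) {b : ℕ} where

  lookup-↑ˡ : ∀ (p : Vec A (a ℕ.+ b)) e → lookup p (e ↑ˡ b) ≡ lookup (take a p) e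
  lookup-↑ˡ p e = trans (cong (λ q → lookup q (e ↑ˡ b)) (sym (take++drop≡id a p))) (lookup-++ˡ (take a p) (drop a p) e)

  lookup-↑ʳ : ∀ (p : Vec A (a ℕ.+ b)) e → lookup p (a ↑ʳ e) ≡ lookup (drop a p) e
  lookup-↑ʳ p e = trans (cong (λ q → lookup q (a ↑ʳ e)) (sym (take++drop≡id a p))) (lookup-++ʳ (take a p) (drop a p) e)

  take-++ : ∀ (p : Vec A a) (q : Vec A b) → take a (p ++ q) ≡ p
  take-++ p q = ++-injectiveˡ (take a (p ++ q)) p (take++drop≡id a (p ++ q))

  drop-++ : ∀ (p : Vec A a) (q : Vec A b) → drop a (p ++ q) ≡ q
  drop-++ p q = ++-injectiveʳ (take a (p ++ q)) p (take++drop≡id a (p ++ q))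

data SplitView (a : ℕ) {b : ℕ} : Fin (a ℕ.+ b) → Set where
  left  : ∀ e → SplitView a (e ↑ˡ b)
  right : ∀ e → SplitView a (a ↑ʳ e)

splitView : ∀ a {b} (x : Fin (a ℕ.+ b)) → SplitView a x
splitView a x with splitAt a x in eq
... | inj₁ e = subst (SplitView a) (splitAt⁻¹-↑ˡ eq) (left e)
... | inj₂ e = subst (SplitView a) (splitAt⁻¹-↑ʳ eq) (right e)

module _ (a : ℕ) {b : ℕ} where

  ∈-take⁺ : ∀ (p : Subset (a ℕ.+ b)) {e} → e ↑ˡ b ∈ p → e ∈ take a p
  ∈-take⁺ p {e} e∈p = lookup⇒[]= e (take a p) (trans (sym (lookup-↑ˡ a p e)) ([]=⇒lookup e∈p))

  ∈-take⁻ : ∀ (p : Subset (a ℕ.+ b)) {e} → e ∈ take a p → e ↑ˡ b ∈ p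
  ∈-take⁻ p {e} e∈p = lookup⇒[]= (e ↑ˡ b) p (trans (lookup-↑ˡ a p e) ([]=⇒lookup e∈p))

  ∈-drop⁺ : ∀ (p : Subset (a ℕ.+ b)) {e} → a ↑ʳ e ∈ p → e ∈ drop a p
  ∈-drop⁺ p {e} e∈p = lookup⇒[]= e (drop a p) (trans (sym (lookup-↑ʳ a p e)) ([]=⇒lookup e∈p))

  ∈-drop⁻ : ∀ (p : Subset (a ℕ.+ b)) {e} → e ∈ drop a p → a ↑ʳ e ∈ p
  ∈-drop⁻ p {e} e∈p = lookup⇒[]= (a ↑ʳ e) p (trans (lookup-↑ʳ a p e) ([]=⇒lookup e∈p))

  ⊆-take : ∀ {p q : Subset (a ℕ.+ b)} → p ⊆ q → take a p ⊆ take a q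
  ⊆-take {p} {q} p⊆q = ∈-take⁺ q ∘ p⊆q ∘ ∈-take⁻ p

  ⊆-drop : ∀ {p q : Subset (a ℕ.+ b)} → p ⊆ q → drop a p ⊆ drop a q
  ⊆-drop {p} {q} p⊆q = ∈-drop⁺ q ∘ p⊆q ∘ ∈-drop⁻ p

  ⊆-split : ∀ {p q : Subset (a ℕ.+ b)} → take a p ⊆ take a q → drop a p ⊆ drop a q → p ⊆ q
  ⊆-split {p} {q} take⊆ drop⊆ {x} x∈p with splitView a x
  ... | left e = ∈-take⁻ q (take⊆ (∈-take⁺ p x∈p))
  ... | right e = ∈-drop⁻ q (drop⊆ (∈-drop⁺ p x∈p))

  take-∪ : ∀ (p q : Subset (a ℕ.+ b)) → take a (p ∪ q) ≡ take a p ∪ take a q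
  take-∪ = take-zipWith _∨_

  drop-∪ : ∀ (p q : Subset (a ℕ.+ b)) → drop a (p ∪ q) ≡ drop a p ∪ drop a q
  drop-∪ = drop-zipWith _∨_

  take-∁∪ : ∀ (p q : Subset (a ℕ.+ b)) → take a (∁ (p ∪ q)) ≡ ∁ (take a p ∪ take a q)
  take-∁∪ p q = trans (take-map not a (p ∪ q)) (cong ∁ (take-∪ p q))

  drop-∁∪ : ∀ (p q : Subset (a ℕ.+ b)) → drop a (∁ (p ∪ q)) ≡ ∁ (drop a p ∪ drop a q)
  drop-∁∪ p q = trans (drop-map not a (p ∪ q)) (cong ∁ (drop-∪ p q))

⊥-++ : ∀ a {b} → ⊥ {a ℕ.+ b} ≡ ⊥ {a} ++ ⊥ {b}
⊥-++ zero = refl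
⊥-++ (suc a) = cong (false Vec.∷_) (⊥-++ a)

⁅↑ˡ⁆ : ∀ {a} b (e : Fin a) → ⁅ e ↑ˡ b ⁆ ≡ ⁅ e ⁆ ++ ⊥ {b}
⁅↑ˡ⁆ {suc a} b zero = cong (true Vec.∷_) (⊥-++ a)
⁅↑ˡ⁆ {suc a} b (suc e) = cong (false Vec.∷_) (⁅↑ˡ⁆ b e)

⁅↑ʳ⁆ : ∀ a {b} (e : Fin b) → ⁅ a ↑ʳ e ⁆ ≡ ⊥ {a} ++ ⁅ e ⁆
⁅↑ʳ⁆ zero e = refl
⁅↑ʳ⁆ (suc a) e = cong (false Vec.∷_) (⁅↑ʳ⁆ a e)

module _ {a b n₁ n₂ : ℕ} (f₁ : Fin n₁ → Fin a) (f₂ : Fin n₂ → Fin b) where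

  _⊕ᶠ_ : Fin (n₁ ℕ.+ n₂) → Fin (a ℕ.+ b)
  _⊕ᶠ_ = join a b ∘ Sum.map f₁ f₂ ∘ splitAt n₁

  ⊕ᶠ-↑ˡ : ∀ i → _⊕ᶠ_ (i ↑ˡ n₂) ≡ f₁ i ↑ˡ b
  ⊕ᶠ-↑ˡ i = cong (join a b ∘ Sum.map f₁ f₂) (splitAt-↑ˡ n₁ i n₂)

  ⊕ᶠ-↑ʳ : ∀ j → _⊕ᶠ_ (n₁ ↑ʳ j) ≡ a ↑ʳ f₂ j
  ⊕ᶠ-↑ʳ j = cong (join a b ∘ Sum.map f₁ f₂) (splitAt-↑ʳ n₁ n₂ j)

  ⊕ᶠ-injective : Injective _≡_ _≡_ f₁ → Injective _≡_ _≡_ f₂ → Injective _≡_ _≡_ _⊕ᶠ_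
  ⊕ᶠ-injective f₁-inj f₂-inj {x} {y} fx≡fy =
    trans (sym (join-splitAt n₁ n₂ x)) (trans (cong (join n₁ n₂) (map-injective (splitAt n₁ x) (splitAt n₁ y) images)) (join-splitAt n₁ n₂ y))
    where
    images : Sum.map f₁ f₂ (splitAt n₁ x) ≡ Sum.map f₁ f₂ (splitAt n₁ y)
    images = trans (sym (splitAt-join a b _)) (trans (cong (splitAt a) fx≡fy) (splitAt-join a b _))
    map-injective : ∀ s t → Sum.map f₁ f₂ s ≡ Sum.map f₁ f₂ t → s ≡ t
    map-injective (inj₁ i) (inj₁ j) eq = cong inj₁ (f₁-inj (inj₁-injective eq))
    map-injective (inj₂ i) (inj₂ j) eq = cong inj₂ (f₂-inj (inj₂-injective eq))
    map-injective (inj₁ i) (inj₂ j) ()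
    map-injective (inj₂ i) (inj₁ j) ()

  take-preimage-⊕ᶠ : ∀ X → take n₁ (preimage _⊕ᶠ_ X) ≡ preimage f₁ (take a X)
  take-preimage-⊕ᶠ X = lookup-ext λ i → begin
    lookup (take n₁ (preimage _⊕ᶠ_ X)) i   ≡⟨ lookup-↑ˡ n₁ (preimage _⊕ᶠ_ X) i ⟨
    lookup (preimage _⊕ᶠ_ X) (i ↑ˡ n₂)     ≡⟨ lookup∘tabulate _ (i ↑ˡ n₂) ⟩
    lookup X (_⊕ᶠ_ (i ↑ˡ n₂))              ≡⟨ cong (lookup X) (⊕ᶠ-↑ˡ i) ⟩
    lookup X (f₁ i ↑ˡ b)                   ≡⟨ lookup-↑ˡ a X (f₁ i) ⟩
    lookup (take a X) (f₁ i)               ≡⟨ lookup∘tabulate _ i ⟨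
    lookup (preimage f₁ (take a X)) i      ∎
    where open ≡-Reasoning

  drop-preimage-⊕ᶠ : ∀ X → drop n₁ (preimage _⊕ᶠ_ X) ≡ preimage f₂ (drop a X)
  drop-preimage-⊕ᶠ X = lookup-ext λ j → begin
    lookup (drop n₁ (preimage _⊕ᶠ_ X)) j   ≡⟨ lookup-↑ʳ n₁ (preimage _⊕ᶠ_ X) j ⟨
    lookup (preimage _⊕ᶠ_ X) (n₁ ↑ʳ j)     ≡⟨ lookup∘tabulate _ (n₁ ↑ʳ j) ⟩
    lookup X (_⊕ᶠ_ (n₁ ↑ʳ j))              ≡⟨ cong (lookup X) (⊕ᶠ-↑ʳ j) ⟩
    lookup X (a ↑ʳ f₂ j)                   ≡⟨ lookup-↑ʳ a X (f₂ j) ⟩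
    lookup (drop a X) (f₂ j)               ≡⟨ lookup∘tabulate _ j ⟨
    lookup (preimage f₂ (drop a X)) j      ∎
    where open ≡-Reasoning

  ⊕ᶠ-∈ : ∀ {E} → (∀ i → f₁ i ∈ take a E) → (∀ j → f₂ j ∈ drop a E) → ∀ x → _⊕ᶠ_ x ∈ E
  ⊕ᶠ-∈ {E} f₁∈ f₂∈ x with splitView n₁ x
  ... | left i = subst (_∈ E) (sym (⊕ᶠ-↑ˡ i)) (∈-take⁻ a E (f₁∈ i))
  ... | right j = subst (_∈ E) (sym (⊕ᶠ-↑ʳ j)) (∈-drop⁻ a E (f₂∈ j))

  ⊕ᶠ-onto : ∀ {E} → (∀ {e} → e ∈ take a E → ∃ λ i → f₁ i ≡ e) → (∀ {e} → e ∈ drop a E → ∃ λ j → f₂ j ≡ e) →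
    ∀ {x} → x ∈ E → ∃ λ y → _⊕ᶠ_ y ≡ x
  ⊕ᶠ-onto {E} onto₁ onto₂ {x} x∈E with splitView a x
  ... | left e = let (i , f₁i≡e) = onto₁ (∈-take⁺ a E x∈E) in i ↑ˡ n₂ , trans (⊕ᶠ-↑ˡ i) (cong (_↑ˡ b) f₁i≡e)
  ... | right e = let (j , f₂j≡e) = onto₂ (∈-drop⁺ a E x∈E) in n₁ ↑ʳ j , trans (⊕ᶠ-↑ʳ j) (cong (a ↑ʳ_) f₂j≡e)

∈⇒∣∁∣≢n : ∀ {n} {p : Subset n} {e} → e ∈ p → ∣ ∁ p ∣ ≢ n
∈⇒∣∁∣≢n {p = p} {e} e∈p ∣∁p∣≡n = x∈p⇒x∉∁p e∈p (subst (e ∈_) (sym (∣p∣≡n⇒p≡⊤ ∣∁p∣≡n)) ∈⊤)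

-- Four columns spanning two planes

asColumns : ∀ {m t} → (Fin t → Fin m → ℤ) → Mat m t
asColumns vs i a = vs a i

*-≢0 : ∀ {x y} → x ≢ 0ℤ → y ≢ 0ℤ → x * y ≢ 0ℤ
*-≢0 {x} x≢0 y≢0 xy≡0 with i*j≡0⇒i≡0∨j≡0 x xy≡0
... | inj₁ x≡0 = x≢0 x≡0
... | inj₂ y≡0 = y≢0 y≡0

*-cancelˡ-≢0 : ∀ {k x y} → k ≢ 0ℤ → k * x ≡ k * y → x ≡ y
*-cancelˡ-≢0 {k} {x} {y} k≢0 = *-cancelˡ-≡ k x y {{≢-nonZero k≢0}}

scaled-≢0 : ∀ k a π D → k * a ≡ π * D → π ≢ 0ℤ → D ≢ 0ℤ → a ≢ 0ℤ
scaled-≢0 k a π D ka≡πD π≢0 D≢0 a≡0 = *-≢0 π≢0 D≢0 (trans (sym ka≡πD) (trans (cong (k *_) a≡0) (*-zeroʳ k)))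

cross-multiply : ∀ k π v X Y D → k ≢ 0ℤ → k * v ≡ π * Y → k * X ≡ π * D → v * D ≡ X * Y
cross-multiply k π v X Y D k≢0 kv≡πY kX≡πD = *-cancelˡ-≢0 k≢0 (begin
  k * (v * D)     ≡⟨ *-assoc k v D ⟨
  k * v * D       ≡⟨ cong (_* D) kv≡πY ⟩
  π * Y * D       ≡⟨ swap-last π Y D ⟩
  π * D * Y       ≡⟨ cong (_* Y) kX≡πD ⟨
  k * X * Y       ≡⟨ *-assoc k X Y ⟩
  k * (X * Y)     ∎)
  where
  swap-last : ∀ a b c → a * b * c ≡ a * c * b
  swap-last = solve-∀

module Minor4 {m} (ρ : Fin 4 → Fin m) where

  restrict : (Fin 4 → Fin m → ℤ) → Mat 4 4
  restrict vs r c = vs c (ρ r)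

  Δᶠ : (Fin 4 → Fin m → ℤ) → ℤ
  Δᶠ vs = det (restrict vs)

  Δ : (u v w z : Fin m → ℤ) → ℤ
  Δ u v w z = Δᶠ (u ∷ v ∷ w ∷ z ∷ [])

  Δᶠ-adjSwap : ∀ i vs → Δᶠ (vs ∘ adjSwap i) ≡ - Δᶠ vs
  Δᶠ-adjSwap i vs = det-swap-adjacent-columns i (restrict vs) (restrict (vs ∘ adjSwap i)) λ r c → refl

  Δ-linear₀ : ∀ {u} x y p q v w z → (∀ i → u i ≡ x * p i + y * q i) → Δ u v w z ≡ x * Δ p v w z + y * Δ q v w z
  Δ-linear₀ {u} x y p q v w z u≡ =
    det-linear-column zero {restrict (p ∷ v ∷ w ∷ z ∷ [])} {restrict (q ∷ v ∷ w ∷ z ∷ [])} x y (same {p} {u}) (same {q} {u}) (u≡ ∘ ρ)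
    where
    same : ∀ {a b} r c → c ≢ zero → (a ∷ v ∷ w ∷ z ∷ []) c (ρ r) ≡ (b ∷ v ∷ w ∷ z ∷ []) c (ρ r)
    same r zero c≢0 = ⊥-elim (c≢0 refl)
    same r (suc c) _ = refl

  Δ-linear₁ : ∀ {v} x y p q u w z → (∀ i → v i ≡ x * p i + y * q i) → Δ u v w z ≡ x * Δ u p w z + y * Δ u q w z
  Δ-linear₁ {v} x y p q u w z v≡ =
    det-linear-column (suc zero) {restrict (u ∷ p ∷ w ∷ z ∷ [])} {restrict (u ∷ q ∷ w ∷ z ∷ [])} x y (same {p} {v}) (same {q} {v}) (v≡ ∘ ρ)
    where
    same : ∀ {a b} r c → c ≢ suc zero → (u ∷ a ∷ w ∷ z ∷ []) c (ρ r) ≡ (u ∷ b ∷ w ∷ z ∷ []) c (ρ r)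
    same r zero _ = refl
    same r (suc zero) c≢1 = ⊥-elim (c≢1 refl)
    same r (suc (suc c)) _ = refl

  Δ-scaled₀ : ∀ {u} e x y p q v w z → (∀ i → e * u i ≡ x * p i + y * q i) → e * Δ u v w z ≡ x * Δ p v w z + y * Δ q v w z
  Δ-scaled₀ {u} e x y p q v w z eu≡ = begin
    e * Δ u v w z                  ≡⟨ scale (e * Δ u v w z) ⟩
    e * Δ u v w z + 0ℤ * Δ u v w z ≡⟨ Δ-linear₀ e 0ℤ u u v w z (λ i → scale (e * u i)) ⟨
    Δ (λ i → e * u i) v w z        ≡⟨ Δ-linear₀ x y p q v w z eu≡ ⟩
    x * Δ p v w z + y * Δ q v w z  ∎
    where
    scale : ∀ a → a ≡ a + 0ℤ * a
    scale a = sym (trans (cong (a +_) (*-zeroˡ a)) (+-identityʳ a))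

  Δ-scaled₁ : ∀ {v} e x y p q u w z → (∀ i → e * v i ≡ x * p i + y * q i) → e * Δ u v w z ≡ x * Δ u p w z + y * Δ u q w z
  Δ-scaled₁ {v} e x y p q u w z ev≡ = begin
    e * Δ u v w z                  ≡⟨ scale (e * Δ u v w z) ⟩
    e * Δ u v w z + 0ℤ * Δ u v w z ≡⟨ Δ-linear₁ e 0ℤ v v u w z (λ i → scale (e * v i)) ⟨
    Δ u (λ i → e * v i) w z        ≡⟨ Δ-linear₁ x y p q u w z ev≡ ⟩
    x * Δ u p w z + y * Δ u q w z  ∎
    where
    scale : ∀ a → a ≡ a + 0ℤ * a
    scale a = sym (trans (cong (a +_) (*-zeroˡ a)) (+-identityʳ a))

  Δ-repeated : ∀ u w z → Δ u u w z ≡ 0ℤ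
  Δ-repeated u w z = det-repeated-column (restrict (u ∷ u ∷ w ∷ z ∷ [])) {zero} {suc zero} (λ ()) λ r → refl

  Δ-swap : ∀ u v w z → Δ v u w z ≡ - Δ u v w z
  Δ-swap u v w z = trans (Δᶠ-cong {v ∷ u ∷ w ∷ z ∷ []} {(u ∷ v ∷ w ∷ z ∷ []) ∘ adjSwap zero} λ { zero _ → refl ; (suc zero) _ → refl ; (suc (suc zero)) _ → refl ; (suc (suc (suc zero))) _ → refl })
                         (Δᶠ-adjSwap zero (u ∷ v ∷ w ∷ z ∷ []))
    where
    Δᶠ-cong : ∀ {vs ws} → (∀ c i → vs c i ≡ ws c i) → Δᶠ vs ≡ Δᶠ ws
    Δᶠ-cong vs≈ws = det-cong λ r c → vs≈ws c (ρ r)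

  -- (w z u v) is the composite of four adjacent transpositions of (u v w z).
  Δ-swap-pairs : ∀ u v w z → Δ w z u v ≡ Δ u v w z
  Δ-swap-pairs u v w z = begin
    Δᶠ (vs ∘ s₁ ∘ s₀ ∘ s₂ ∘ s₁)        ≡⟨ Δᶠ-adjSwap (suc zero) (vs ∘ s₁ ∘ s₀ ∘ s₂) ⟩
    - Δᶠ (vs ∘ s₁ ∘ s₀ ∘ s₂)           ≡⟨ cong -_ (Δᶠ-adjSwap (suc (suc zero)) (vs ∘ s₁ ∘ s₀)) ⟩
    - - Δᶠ (vs ∘ s₁ ∘ s₀)              ≡⟨ cong (-_ ∘ -_) (Δᶠ-adjSwap zero (vs ∘ s₁)) ⟩
    - - - Δᶠ (vs ∘ s₁)                 ≡⟨ cong (-_ ∘ -_ ∘ -_) (Δᶠ-adjSwap (suc zero) vs) ⟩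
    - - - - Δᶠ vs                      ≡⟨ trans (neg-involutive _) (neg-involutive _) ⟩
    Δᶠ vs                              ∎
    where
    vs = u ∷ v ∷ w ∷ z ∷ []
    s₀ s₁ s₂ : Fin 4 → Fin 4
    s₀ = adjSwap zero
    s₁ = adjSwap (suc zero)
    s₂ = adjSwap (suc (suc zero))

  Δ-change-basis₀₁ : ∀ {u v} e e′ α β α′ β′ p q w z →
    (∀ i → e * u i ≡ α * p i + β * q i) → (∀ i → e′ * v i ≡ α′ * p i + β′ * q i) →
    e * e′ * Δ u v w z ≡ (α * β′ - β * α′) * Δ p q w z
  Δ-change-basis₀₁ {u} {v} e e′ α β α′ β′ p q w z eu≡ e′v≡ = begin
    e * e′ * Δ u v w z                                         ≡⟨ ring₁ e e′ (Δ u v w z) ⟩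
    e′ * (e * Δ u v w z)                                       ≡⟨ cong (e′ *_) (Δ-scaled₀ e α β p q v w z eu≡) ⟩
    e′ * (α * Δ p v w z + β * Δ q v w z)                       ≡⟨ ring₂ e′ α β (Δ p v w z) (Δ q v w z) ⟩
    α * (e′ * Δ p v w z) + β * (e′ * Δ q v w z)                ≡⟨ cong₂ (λ a b → α * a + β * b) (Δ-scaled₁ e′ α′ β′ p q p w z e′v≡) (Δ-scaled₁ e′ α′ β′ p q q w z e′v≡) ⟩
    α * (α′ * Δ p p w z + β′ * Δ p q w z) + β * (α′ * Δ q p w z + β′ * Δ q q w z)
      ≡⟨ cong₂ (λ a b → α * (α′ * a + β′ * Δ p q w z) + β * (α′ * Δ q p w z + β′ * b)) (Δ-repeated p w z) (Δ-repeated q w z) ⟩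
    α * (α′ * 0ℤ + β′ * Δ p q w z) + β * (α′ * Δ q p w z + β′ * 0ℤ)
      ≡⟨ cong (λ a → α * (α′ * 0ℤ + β′ * Δ p q w z) + β * (α′ * a + β′ * 0ℤ)) (Δ-swap p q w z) ⟩
    α * (α′ * 0ℤ + β′ * Δ p q w z) + β * (α′ * - Δ p q w z + β′ * 0ℤ)  ≡⟨ ring₃ α β α′ β′ (Δ p q w z) ⟩
    (α * β′ - β * α′) * Δ p q w z                              ∎
    where
    ring₁ : ∀ e e′ d → e * e′ * d ≡ e′ * (e * d)
    ring₁ = solve-∀
    ring₂ : ∀ e′ α β x y → e′ * (α * x + β * y) ≡ α * (e′ * x) + β * (e′ * y)
    ring₂ = solve-∀
    ring₃ : ∀ α β α′ β′ d → α * (α′ * 0ℤ + β′ * d) + β * (α′ * - d + β′ * 0ℤ) ≡ (α * β′ - β * α′) * d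
    ring₃ = solve-∀

  Δ-change-basis₂₃ : ∀ {u v} e e′ α β α′ β′ p q w z →
    (∀ i → e * u i ≡ α * p i + β * q i) → (∀ i → e′ * v i ≡ α′ * p i + β′ * q i) →
    e * e′ * Δ w z u v ≡ (α * β′ - β * α′) * Δ w z p q
  Δ-change-basis₂₃ {u} {v} e e′ α β α′ β′ p q w z eu≡ e′v≡ = begin
    e * e′ * Δ w z u v                ≡⟨ cong (e * e′ *_) (Δ-swap-pairs u v w z) ⟩
    e * e′ * Δ u v w z                ≡⟨ Δ-change-basis₀₁ e e′ α β α′ β′ p q w z eu≡ e′v≡ ⟩
    (α * β′ - β * α′) * Δ p q w z     ≡⟨ cong ((α * β′ - β * α′) *_) (Δ-swap-pairs p q w z) ⟨
    (α * β′ - β * α′) * Δ w z p q     ∎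

Plücker : (Fin 4 → Fin 4 → ℤ) → Set
Plücker X = X 0F 1F * X 2F 3F - X 0F 2F * X 1F 3F + X 0F 3F * X 1F 2F ≡ 0ℤ

-- The 2 × 2 minors of any 2 × 4 matrix satisfy the Plücker relation; it survives nonzero rescaling.
scaled-minors-plücker : ∀ (e α β : Fin 4 → ℤ) D (X : Fin 4 → Fin 4 → ℤ) → (∀ x → e x ≢ 0ℤ) →
  (∀ x y → e x * e y * X x y ≡ (α x * β y - β x * α y) * D) → Plücker X
scaled-minors-plücker e α β D X e≢0 eeX≡πD = *-cancelˡ-≢0 (*-≢0 (*-≢0 (*-≢0 (e≢0 0F) (e≢0 1F)) (e≢0 2F)) (e≢0 3F)) (begin
  E * (X 0F 1F * X 2F 3F - X 0F 2F * X 1F 3F + X 0F 3F * X 1F 2F)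
    ≡⟨ regroup (e 0F) (e 1F) (e 2F) (e 3F) (X 0F 1F) (X 2F 3F) (X 0F 2F) (X 1F 3F) (X 0F 3F) (X 1F 2F) ⟩
  s 0F 1F * s 2F 3F - s 0F 2F * s 1F 3F + s 0F 3F * s 1F 2F
    ≡⟨ cong₂ _+_ (cong₂ _-_ (cong₂ _*_ (eeX≡πD 0F 1F) (eeX≡πD 2F 3F)) (cong₂ _*_ (eeX≡πD 0F 2F) (eeX≡πD 1F 3F)))
                  (cong₂ _*_ (eeX≡πD 0F 3F) (eeX≡πD 1F 2F)) ⟩
  π 0F 1F * D * (π 2F 3F * D) - π 0F 2F * D * (π 1F 3F * D) + π 0F 3F * D * (π 1F 2F * D)
    ≡⟨ plücker (α 0F) (β 0F) (α 1F) (β 1F) (α 2F) (β 2F) (α 3F) (β 3F) D ⟩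
  0ℤ
    ≡⟨ *-zeroʳ E ⟨
  E * 0ℤ  ∎)
  where
  E = e 0F * e 1F * e 2F * e 3F
  s : Fin 4 → Fin 4 → ℤ
  s x y = e x * e y * X x y
  π : Fin 4 → Fin 4 → ℤ
  π x y = α x * β y - β x * α y
  regroup : ∀ e₀ e₁ e₂ e₃ x₀₁ x₂₃ x₀₂ x₁₃ x₀₃ x₁₂ →
    e₀ * e₁ * e₂ * e₃ * (x₀₁ * x₂₃ - x₀₂ * x₁₃ + x₀₃ * x₁₂)
      ≡ e₀ * e₁ * x₀₁ * (e₂ * e₃ * x₂₃) - e₀ * e₂ * x₀₂ * (e₁ * e₃ * x₁₃) + e₀ * e₃ * x₀₃ * (e₁ * e₂ * x₁₂)
  regroup = solve-∀
  plücker : ∀ a₀ b₀ a₁ b₁ a₂ b₂ a₃ b₃ D →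
    (a₀ * b₁ - b₀ * a₁) * D * ((a₂ * b₃ - b₂ * a₃) * D) - (a₀ * b₂ - b₀ * a₂) * D * ((a₁ * b₃ - b₁ * a₃) * D)
      + (a₀ * b₃ - b₀ * a₃) * D * ((a₁ * b₂ - b₁ * a₂) * D) ≡ 0ℤ
  plücker = solve-∀

data OffBasisPair : Fin 4 → Fin 4 → Set where
  pair₀₂ : OffBasisPair 0F 2F
  pair₀₃ : OffBasisPair 0F 3F
  pair₁₂ : OffBasisPair 1F 2F
  pair₁₃ : OffBasisPair 1F 3F
  pair₂₃ : OffBasisPair 2F 3F

data Unit : ℤ → Set where
  plus  : Unit 1ℤ
  minus : Unit -1ℤ

unit-times-abs : ∀ u → ∃ λ s → Unit s × u ≡ s * ℤ.+ ℤ.∣ u ∣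
unit-times-abs (ℤ.+ n) = 1ℤ , plus , sym (*-identityˡ (ℤ.+ n))
unit-times-abs ℤ.-[1+ n ] = -1ℤ , minus , sym (-1*i≡-i (ℤ.+ suc n))

alternating-units≢0 : ∀ {a b c} → Unit a → Unit b → Unit c → a - b + c ≢ 0ℤ
alternating-units≢0 plus  plus  plus  ()
alternating-units≢0 plus  plus  minus ()
alternating-units≢0 plus  minus plus  ()
alternating-units≢0 plus  minus minus ()
alternating-units≢0 minus plus  plus  ()
alternating-units≢0 minus plus  minus ()
alternating-units≢0 minus minus plus  ()
alternating-units≢0 minus minus minus ()

-- ±n ∓ n ± n is an odd multiple of n.
equal-abs-alternating-sum≢0 : ∀ u v w n → n ≢ 0 → ℤ.∣ u ∣ ≡ n → ℤ.∣ v ∣ ≡ n → ℤ.∣ w ∣ ≡ n → u - v + w ≢ 0ℤ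
equal-abs-alternating-sum≢0 u v w n n≢0 refl ∣v∣≡n ∣w∣≡n u-v+w≡0 =
  *-≢0 (alternating-units≢0 a-unit b-unit c-unit) (n≢0 ∘ +-injective) (begin
    (a - b + c) * ℤ.+ n                   ≡⟨ distrib a b c (ℤ.+ n) ⟩
    a * ℤ.+ n - b * ℤ.+ n + c * ℤ.+ n     ≡⟨ cong₂ (λ x y → a * ℤ.+ n - x + y) (cong (λ k → b * ℤ.+ k) (sym ∣v∣≡n)) (cong (λ k → c * ℤ.+ k) (sym ∣w∣≡n)) ⟩
    a * ℤ.+ n - b * ℤ.+ ℤ.∣ v ∣ + c * ℤ.+ ℤ.∣ w ∣  ≡⟨ cong₂ (λ x y → x - y + c * ℤ.+ ℤ.∣ w ∣) (sym u≡) (sym v≡) ⟩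
    u - v + c * ℤ.+ ℤ.∣ w ∣                 ≡⟨ cong (u - v +_) (sym w≡) ⟩
    u - v + w                             ≡⟨ u-v+w≡0 ⟩
    0ℤ                                    ∎)
  where
  a = proj₁ (unit-times-abs u)
  a-unit = proj₁ (proj₂ (unit-times-abs u))
  u≡ = proj₂ (proj₂ (unit-times-abs u))
  b = proj₁ (unit-times-abs v)
  b-unit = proj₁ (proj₂ (unit-times-abs v))
  v≡ = proj₂ (proj₂ (unit-times-abs v))
  c = proj₁ (unit-times-abs w)
  c-unit = proj₁ (proj₂ (unit-times-abs w))
  w≡ = proj₂ (proj₂ (unit-times-abs w))
  distrib : ∀ a b c n → (a - b + c) * n ≡ a * n - b * n + c * n
  distrib = solve-∀

plücker⇒unequal-abs : ∀ (X : Fin 4 → Fin 4 → ℤ) → X 0F 1F ≢ 0ℤ → Plücker X →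
  ∃₂ λ x y → OffBasisPair x y × ℤ.∣ X x y ∣ ≢ ℤ.∣ X 0F 1F ∣
plücker⇒unequal-abs X X₀₁≢0 plücker
  with ℤ.∣ X 0F 2F ∣ ℕ.≟ d | ℤ.∣ X 0F 3F ∣ ℕ.≟ d | ℤ.∣ X 1F 2F ∣ ℕ.≟ d | ℤ.∣ X 1F 3F ∣ ℕ.≟ d | ℤ.∣ X 2F 3F ∣ ℕ.≟ d
  where d = ℤ.∣ X 0F 1F ∣
... | no ≢d | _     | _     | _     | _     = 0F , 2F , pair₀₂ , ≢d
... | yes _ | no ≢d | _     | _     | _     = 0F , 3F , pair₀₃ , ≢d
... | yes _ | yes _ | no ≢d | _     | _     = 1F , 2F , pair₁₂ , ≢d
... | yes _ | yes _ | yes _ | no ≢d | _     = 1F , 3F , pair₁₃ , ≢d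
... | yes _ | yes _ | yes _ | yes _ | no ≢d = 2F , 3F , pair₂₃ , ≢d
... | yes ∣02∣ | yes ∣03∣ | yes ∣12∣ | yes ∣13∣ | yes ∣23∣ = ⊥-elim (equal-abs-alternating-sum≢0 (X 0F 1F * X 2F 3F) (X 0F 2F * X 1F 3F) (X 0F 3F * X 1F 2F) (d ℕ.* d) d²≢0
      (trans (abs-* (X 0F 1F) (X 2F 3F)) (cong (d ℕ.*_) ∣23∣))
      (trans (abs-* (X 0F 2F) (X 1F 3F)) (cong₂ ℕ._*_ ∣02∣ ∣13∣))
      (trans (abs-* (X 0F 3F) (X 1F 2F)) (cong₂ ℕ._*_ ∣03∣ ∣12∣)) plücker)
  where
  d = ℤ.∣ X 0F 1F ∣
  d²≢0 : d ℕ.* d ≢ 0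
  d²≢0 d²≡0 with ℕ.m*n≡0⇒m≡0∨n≡0 d d²≡0
  ... | inj₁ d≡0 = X₀₁≢0 (∣i∣≡0⇒i≡0 d≡0)
  ... | inj₂ d≡0 = X₀₁≢0 (∣i∣≡0⇒i≡0 d≡0)

data OneOrTwo : ℕ → Set where
  one : OneOrTwo 1
  two : OneOrTwo 2

oneOrTwo : ∀ {x} → x ≢ 0ℤ → ℤ.∣ x ∣ ℕ.≤ 2 → OneOrTwo ℤ.∣ x ∣
oneOrTwo {ℤ.+ 0} x≢0 _ = ⊥-elim (x≢0 refl)
oneOrTwo {ℤ.+ 1} _ _ = one
oneOrTwo {ℤ.+ 2} _ _ = two
oneOrTwo {ℤ.+ suc (suc (suc _))} _ (ℕ.s≤s (ℕ.s≤s ()))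
oneOrTwo {ℤ.-[1+ 0 ]} _ _ = one
oneOrTwo {ℤ.-[1+ 1 ]} _ _ = two
oneOrTwo {ℤ.-[1+ suc (suc _) ]} _ (ℕ.s≤s (ℕ.s≤s ()))

-- If d = 1 then x = y = 2 and v = 4; if d = 2 then x = y = 1 and 2 v = 1.
no-small-solution : ∀ {v d x y} → v ℕ.≤ 2 → OneOrTwo d → OneOrTwo x → OneOrTwo y → x ≢ d → y ≢ d → v ℕ.* d ≢ x ℕ.* y
no-small-solution _ one one _ x≢d _ _ = x≢d refl
no-small-solution _ one two one _ y≢d _ = y≢d refl
no-small-solution {v} v≤2 one two two _ _ v*1≡4 with trans (sym (ℕ.*-identityʳ v)) v*1≡4
no-small-solution v≤2 one two two _ _ _ | refl with v≤2
... | ℕ.s≤s (ℕ.s≤s ())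
no-small-solution _ two one two _ y≢d _ = y≢d refl
no-small-solution _ two two _ x≢d _ _ = x≢d refl
no-small-solution {zero} _ two one one _ _ ()
no-small-solution {suc v} _ two one one _ _ ()

record NondegenerateRelation {m} (u p q : Fin m → ℤ) : Set where
  field
    e α β : ℤ
    e≢0 : e ≢ 0ℤ
    α≢0 : α ≢ 0ℤ
    β≢0 : β ≢ 0ℤ
    relation : ∀ i → e * u i ≡ α * p i + β * q i

¬¬nondegenerate-relation : ∀ {m} {u p q : Fin m → ℤ} →
  IndependentColumns (asColumns (p ∷ q ∷ [])) → ¬ IndependentColumns (asColumns (u ∷ p ∷ q ∷ [])) →
  IndependentColumns (asColumns (u ∷ p ∷ [])) → IndependentColumns (asColumns (u ∷ q ∷ [])) →
  ¬ ¬ NondegenerateRelation u p q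
¬¬nondegenerate-relation {u = u} {p} {q} pq-ind upq-dep up-ind uq-ind none =
  dependent-extension (asColumns (u ∷ p ∷ q ∷ [])) pq-ind upq-dep λ (μ , μ₀≢0 , kernel) → none record
    { e = μ 0F ; α = - μ 1F ; β = - μ 2F
    ; e≢0 = μ₀≢0
    ; α≢0 = λ -μ₁≡0 → μ₀≢0 (uq-ind (μ 0F ∷ μ 2F ∷ []) (drop₁ μ kernel (neg≡0 -μ₁≡0)) 0F)
    ; β≢0 = λ -μ₂≡0 → μ₀≢0 (up-ind (μ 0F ∷ μ 1F ∷ []) (drop₂ μ kernel (neg≡0 -μ₂≡0)) 0F)
    ; relation = λ i → solve-for-u (u i) (p i) (q i) (μ 0F) (μ 1F) (μ 2F) (kernel i)
    }
  where
  neg≡0 : ∀ {x} → - x ≡ 0ℤ → x ≡ 0ℤ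
  neg≡0 {x} -x≡0 = trans (sym (neg-involutive x)) (cong -_ -x≡0)
  solve-for-u : ∀ u p q a b c → u * a + (p * b + (q * c + 0ℤ)) ≡ 0ℤ → a * u ≡ - b * p + - c * q
  solve-for-u u p q a b c sum≡0 = begin
    a * u                                                      ≡⟨ shift u p q a b c ⟩
    (- b * p + - c * q) + (u * a + (p * b + (q * c + 0ℤ)))     ≡⟨ cong ((- b * p + - c * q) +_) sum≡0 ⟩
    (- b * p + - c * q) + 0ℤ                                   ≡⟨ +-identityʳ _ ⟩
    - b * p + - c * q                                          ∎
    where
    shift : ∀ u p q a b c → a * u ≡ (- b * p + - c * q) + (u * a + (p * b + (q * c + 0ℤ)))
    shift = solve-∀
  drop₁ : ∀ μ → InKernel (asColumns (u ∷ p ∷ q ∷ [])) μ → μ 1F ≡ 0ℤ → InKernel (asColumns (u ∷ q ∷ [])) (μ 0F ∷ μ 2F ∷ [])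
  drop₁ μ kernel μ₁≡0 i = trans (cong (λ x → u i * μ 0F + x) (sym (trans (cong (λ y → p i * y + (q i * μ 2F + 0ℤ)) μ₁≡0)
                                  (trans (cong (_+ (q i * μ 2F + 0ℤ)) (*-zeroʳ (p i))) (+-identityˡ _)))))
                          (kernel i)
  drop₂ : ∀ μ → InKernel (asColumns (u ∷ p ∷ q ∷ [])) μ → μ 2F ≡ 0ℤ → InKernel (asColumns (u ∷ p ∷ [])) (μ 0F ∷ μ 1F ∷ [])
  drop₂ μ kernel μ₂≡0 i = trans (cong (λ x → u i * μ 0F + (p i * μ 1F + x)) (sym (trans (cong (λ y → q i * y + 0ℤ) μ₂≡0)
                                  (cong (_+ 0ℤ) (*-zeroʳ (q i))))))
                          (kernel i)

-- β′ e u - β e′ u′ = (α β′ - β α′) p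
relations-independent : ∀ {m} {u u′ p q : Fin m → ℤ} (r : NondegenerateRelation u p q) (r′ : NondegenerateRelation u′ p q) →
  IndependentColumns (asColumns (u ∷ u′ ∷ [])) →
  let open NondegenerateRelation in α r * β r′ - β r * α r′ ≢ 0ℤ
relations-independent {u = u} {u′} {p} {q} r r′ uu′-ind π≡0 =
  *-≢0 (β≢0 r′) (e≢0 r) (uu′-ind (β r′ * e r ∷ - (β r * e r′) ∷ []) kernel 0F)
  where
  open NondegenerateRelation
  kernel : InKernel (asColumns (u ∷ u′ ∷ [])) (β r′ * e r ∷ - (β r * e r′) ∷ [])
  kernel i = begin
    u i * (β r′ * e r) + (u′ i * - (β r * e r′) + 0ℤ)        ≡⟨ regroup (u i) (u′ i) (β r′) (e r) (β r) (e r′) ⟩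
    β r′ * (e r * u i) - β r * (e r′ * u′ i)                  ≡⟨ cong₂ (λ x y → β r′ * x - β r * y) (relation r i) (relation r′ i) ⟩
    β r′ * (α r * p i + β r * q i) - β r * (α r′ * p i + β r′ * q i)  ≡⟨ collect (β r′) (β r) (α r) (α r′) (p i) (q i) ⟩
    (α r * β r′ - β r * α r′) * p i                           ≡⟨ cong (_* p i) π≡0 ⟩
    0ℤ                                                        ∎
    where
    regroup : ∀ u u′ b′ e b e′ → u * (b′ * e) + (u′ * - (b * e′) + 0ℤ) ≡ b′ * (e * u) - b * (e′ * u′)
    regroup = solve-∀
    collect : ∀ b′ b a a′ p q → b′ * (a * p + b * q) - b * (a′ * p + b′ * q) ≡ (a * b′ - b * a′) * p
    collect = solve-∀

record U24Coordinates {m} (c : Fin 4 → Fin m → ℤ) : Set where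
  field
    e α β : Fin 4 → ℤ
    e≢0 : ∀ x → e x ≢ 0ℤ
    coordinates : ∀ x i → e x * c x i ≡ α x * c 0F i + β x * c 1F i
    π≢0 : ∀ {x y} → OffBasisPair x y → α x * β y - β x * α y ≢ 0ℤ

u24Coordinates : ∀ {m} (c : Fin 4 → Fin m → ℤ) → NondegenerateRelation (c 2F) (c 0F) (c 1F) → NondegenerateRelation (c 3F) (c 0F) (c 1F) →
  IndependentColumns (asColumns (c 2F ∷ c 3F ∷ [])) → U24Coordinates c
u24Coordinates c r₂ r₃ c₂c₃-ind = record
  { e = 1ℤ ∷ 1ℤ ∷ e r₂ ∷ e r₃ ∷ []
  ; α = 1ℤ ∷ 0ℤ ∷ α r₂ ∷ α r₃ ∷ []
  ; β = 0ℤ ∷ 1ℤ ∷ β r₂ ∷ β r₃ ∷ []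
  ; e≢0 = λ { zero () ; (suc zero) () ; (suc (suc zero)) → e≢0 r₂ ; (suc (suc (suc zero))) → e≢0 r₃ }
  ; coordinates = λ { zero i → first (c 0F i) (c 1F i) ; (suc zero) i → second (c 0F i) (c 1F i)
                    ; (suc (suc zero)) → relation r₂ ; (suc (suc (suc zero))) → relation r₃ }
  ; π≢0 = λ { pair₀₂ → β≢0 r₂ ∘ trans (sym (π₀ (α r₂) (β r₂))) ; pair₀₃ → β≢0 r₃ ∘ trans (sym (π₀ (α r₃) (β r₃)))
            ; pair₁₂ → α≢0 r₂ ∘ neg≡0 ∘ trans (sym (π₁ (α r₂) (β r₂))) ; pair₁₃ → α≢0 r₃ ∘ neg≡0 ∘ trans (sym (π₁ (α r₃) (β r₃)))
            ; pair₂₃ → relations-independent r₂ r₃ c₂c₃-ind }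
  }
  where
  open NondegenerateRelation
  first : ∀ u v → 1ℤ * u ≡ 1ℤ * u + 0ℤ * v
  first = solve-∀
  second : ∀ u v → 1ℤ * v ≡ 0ℤ * u + 1ℤ * v
  second = solve-∀
  π₀ : ∀ a b → 1ℤ * b - 0ℤ * a ≡ b
  π₀ = solve-∀
  π₁ : ∀ a b → 0ℤ * b - 1ℤ * a ≡ - a
  π₁ = solve-∀
  neg≡0 : ∀ {x} → - x ≡ 0ℤ → x ≡ 0ℤ
  neg≡0 {x} -x≡0 = trans (sym (neg-involutive x)) (cong -_ -x≡0)

¬¬u24Coordinates : ∀ {m} (c : Fin 4 → Fin m → ℤ) →
  (∀ {x y} → x ≢ y → IndependentColumns (asColumns (c x ∷ c y ∷ []))) →
  ¬ IndependentColumns (asColumns (c 2F ∷ c 0F ∷ c 1F ∷ [])) → ¬ IndependentColumns (asColumns (c 3F ∷ c 0F ∷ c 1F ∷ [])) →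
  ¬ ¬ U24Coordinates c
¬¬u24Coordinates c pairs dep₂ dep₃ none =
  ¬¬nondegenerate-relation (pairs λ ()) dep₂ (pairs λ ()) (pairs λ ()) λ r₂ →
  ¬¬nondegenerate-relation (pairs λ ()) dep₃ (pairs λ ()) (pairs λ ()) λ r₃ →
  none (u24Coordinates c r₂ r₃ (pairs λ ()))

module _ {m} (ρ : Fin 4 → Fin m) {c d : Fin 4 → Fin m → ℤ} (C : U24Coordinates c) (D : U24Coordinates d) where
  open Minor4 ρ
  open U24Coordinates

  -- With D₀ = Δ(c₀ c₁ d₀ d₁), every minor Δ(c_x c_y d_z d_w) satisfies Δ(c_x c_y d_z d_w) · D₀ = Δ(c_x c_y d₀ d₁) · Δ(c₀ c₁ d_z d_w).
  u24-pair-minors-unbounded : Δ (c 0F) (c 1F) (d 0F) (d 1F) ≢ 0ℤ →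
    ¬ (∀ x y z w → ℤ.∣ Δ (c x) (c y) (d z) (d w) ∣ ℕ.≤ 2)
  u24-pair-minors-unbounded D₀≢0 bounded =
    no-small-solution (bounded x y z w) (oneOrTwo D₀≢0 (bounded 0F 1F 0F 1F))
      (oneOrTwo Xxy≢0 (bounded x y 0F 1F)) (oneOrTwo Yzw≢0 (bounded 0F 1F z w)) ∣Xxy∣≢ ∣Yzw∣≢
      (trans (sym (abs-* v D₀)) (trans (cong ℤ.∣_∣ vD₀≡XY) (abs-* (X x y) (Y z w))))
    where
    D₀ = Δ (c 0F) (c 1F) (d 0F) (d 1F)
    X Y : Fin 4 → Fin 4 → ℤ
    X x y = Δ (c x) (c y) (d 0F) (d 1F)
    Y z w = Δ (c 0F) (c 1F) (d z) (d w)
    π : ∀ {f} → U24Coordinates f → Fin 4 → Fin 4 → ℤ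
    π F x y = α F x * β F y - β F x * α F y
    eeX : ∀ x y → e C x * e C y * X x y ≡ π C x y * D₀
    eeX x y = Δ-change-basis₀₁ (e C x) (e C y) (α C x) (β C x) (α C y) (β C y) (c 0F) (c 1F) (d 0F) (d 1F) (coordinates C x) (coordinates C y)
    eeY : ∀ z w → e D z * e D w * Y z w ≡ π D z w * D₀
    eeY z w = Δ-change-basis₂₃ (e D z) (e D w) (α D z) (β D z) (α D w) (β D w) (d 0F) (d 1F) (c 0F) (c 1F) (coordinates D z) (coordinates D w)
    unequalX = plücker⇒unequal-abs X D₀≢0 (scaled-minors-plücker (e C) (α C) (β C) D₀ X (e≢0 C) eeX)
    unequalY = plücker⇒unequal-abs Y D₀≢0 (scaled-minors-plücker (e D) (α D) (β D) D₀ Y (e≢0 D) eeY)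
    x = proj₁ unequalX
    y = proj₁ (proj₂ unequalX)
    z = proj₁ unequalY
    w = proj₁ (proj₂ unequalY)
    ∣Xxy∣≢ = proj₂ (proj₂ (proj₂ unequalX))
    ∣Yzw∣≢ = proj₂ (proj₂ (proj₂ unequalY))
    Xxy≢0 : X x y ≢ 0ℤ
    Xxy≢0 = scaled-≢0 (e C x * e C y) (X x y) (π C x y) D₀ (eeX x y) (π≢0 C (proj₁ (proj₂ (proj₂ unequalX)))) D₀≢0
    Yzw≢0 : Y z w ≢ 0ℤ
    Yzw≢0 = scaled-≢0 (e D z * e D w) (Y z w) (π D z w) D₀ (eeY z w) (π≢0 D (proj₁ (proj₂ (proj₂ unequalY)))) D₀≢0
    v = Δ (c x) (c y) (d z) (d w)
    eev : e C x * e C y * v ≡ π C x y * Y z w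
    eev = Δ-change-basis₀₁ (e C x) (e C y) (α C x) (β C x) (α C y) (β C y) (c 0F) (c 1F) (d z) (d w) (coordinates C x) (coordinates C y)
    vD₀≡XY : v * D₀ ≡ X x y * Y z w
    vD₀≡XY = cross-multiply (e C x * e C y) (π C x y) v (X x y) (Y z w) D₀ (*-≢0 (e≢0 C x) (e≢0 C y)) eev (eeX x y)

-- U₂,₄ ⊕ U₂,₄ is not in 𝓜₂

u24⊕u24? : ∀ X → Dec (U24⊕U24 X)
u24⊕u24? X = (∣ take 4 X ∣ ℕ.≤? 2) ×-dec (∣ drop 4 X ∣ ℕ.≤? 2)

distinct-pairs-independent : ∀ {x y : Fin 8} → x ≢ y → U24⊕U24 (image (x ∷ y ∷ []))
distinct-pairs-independent {x} {y} = from-yes (all? λ x → all? λ y → ¬? (x ≟ᶠ y) →-dec u24⊕u24? (image (x ∷ y ∷ []))) x y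

injective? : ∀ {s n} (τ : Fin s → Fin n) → Dec (∀ a b → τ a ≡ τ b → a ≡ b)
injective? τ = all? λ a → all? λ b → (τ a ≟ᶠ τ b) →-dec (a ≟ᶠ b)

pair-injective : ∀ {n} {x y : Fin n} → x ≢ y → Injective _≡_ _≡_ (x ∷ y ∷ [])
pair-injective x≢y {0F} {0F} _ = refl
pair-injective x≢y {0F} {1F} x≡y = ⊥-elim (x≢y x≡y)
pair-injective x≢y {1F} {0F} y≡x = ⊥-elim (x≢y (sym y≡x))
pair-injective x≢y {1F} {1F} _ = refl

module U24⊕U24Representation {k m} {A : Mat m k} {f : Fin k → Fin 8} (f-inj : Injective _≡_ _≡_ f)
  (f-onto : ∀ x → ∃ λ j → f j ≡ x) (represents : ∀ X → U24⊕U24 X ⇔ ColIndep A (preimage f X)) where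

  g : Fin 8 → Fin k
  g x = proj₁ (f-onto x)

  f∘g : ∀ x → f (g x) ≡ x
  f∘g x = proj₂ (f-onto x)

  g-inj : Injective _≡_ _≡_ g
  g-inj {x} {y} gx≡gy = trans (sym (f∘g x)) (trans (cong f gx≡gy) (f∘g y))

  ∈-preimage : ∀ {X j} → f j ∈ X → j ∈ preimage f X
  ∈-preimage {X} {j} fj∈X = lookup⇒[]= j (preimage f X) (trans (lookup∘tabulate _ j) ([]=⇒lookup fj∈X))

  ∈-preimage⁻ : ∀ {X j} → j ∈ preimage f X → f j ∈ X
  ∈-preimage⁻ {X} {j} j∈f⁻¹X = lookup⇒[]= (f j) X (trans (sym (lookup∘tabulate _ j)) ([]=⇒lookup j∈f⁻¹X))

  independent : ∀ {s} (τ : Fin s → Fin 8) → Injective _≡_ _≡_ τ → U24⊕U24 (image τ) → IndependentColumns (columns A (g ∘ τ))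
  independent τ τ-inj indep = ColIndep⇒independent A (τ-inj ∘ g-inj)
    (λ a → ∈-preimage (subst (_∈ image τ) (sym (f∘g (τ a))) (image-∈ τ a)))
    (Equivalence.to (represents (image τ)) indep)

  dependent : ∀ {s} (τ : Fin s → Fin 8) → Injective _≡_ _≡_ τ → ¬ U24⊕U24 (image τ) → ¬ IndependentColumns (columns A (g ∘ τ))
  dependent τ τ-inj dep ind = dep (Equivalence.from (represents (image τ)) (independent⇒ColIndep A (τ-inj ∘ g-inj) onto ind))
    where
    onto : ∀ j → j ∈ preimage f (image τ) → ∃ λ a → g (τ a) ≡ j
    onto j j∈ = let (a , τa≡fj) = image-onto τ (∈-preimage⁻ j∈) in a , trans (cong g τa≡fj) (f-inj (f∘g (f j)))

  basis : Fin 4 → Fin 8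
  basis = 0F ∷ 1F ∷ 4F ∷ 5F ∷ []

  basis-injective : Injective _≡_ _≡_ basis
  basis-injective {a} {b} = from-yes (injective? basis) a b

  rank≡4 : IsRank A 4
  rank≡4 = (preimage f (image basis) , basis-ColIndep , ℕ.≤-antisym ∣S∣≤4 4≤∣S∣) , maximal
    where
    basis-ColIndep = Equivalence.to (represents (image basis)) (from-yes (u24⊕u24? (image basis)))
    ∣S∣≤4 = ∣∣-injection f f-inj ∈-preimage⁻
    4≤∣S∣ = ∣∣-injection g g-inj λ {x} x∈B → ∈-preimage (subst (_∈ image basis) (sym (f∘g x)) x∈B)
    maximal : ∀ S → ColIndep A S → ∣ S ∣ ℕ.≤ 4
    maximal S S-ind = ℕ.≤-trans (∣∣-injection f f-inj f∈X) (subst (ℕ._≤ 4) (sym (∣∣-take-drop 4 X)) (ℕ.+-mono-≤ (proj₁ X-indep) (proj₂ X-indep)))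
      where
      X : Subset 8
      X = tabulate (lookup S ∘ g)
      f⁻¹X≡S : preimage f X ≡ S
      f⁻¹X≡S = trans (tabulate-cong λ j → trans (lookup∘tabulate (lookup S ∘ g) (f j)) (cong (lookup S) (f-inj (f∘g (f j))))) (tabulate∘lookup S)
      X-indep : U24⊕U24 X
      X-indep = Equivalence.from (represents X) (subst (ColIndep A) (sym f⁻¹X≡S) S-ind)
      f∈X : ∀ {j} → j ∈ S → f j ∈ X
      f∈X j∈S = ∈-preimage⁻ (subst (_ ∈_) (sym f⁻¹X≡S) j∈S)

  column : Fin 8 → Fin m → ℤ
  column x i = A i (g x)

  side₁ side₂ : Fin 4 → Fin 8
  side₁ x = x ↑ˡ 4
  side₂ x = 4 ↑ʳ x

  distinct-independent : ∀ (side : Fin 4 → Fin 8) → Injective _≡_ _≡_ side →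
    ∀ {x y} → x ≢ y → IndependentColumns (asColumns (column (side x) ∷ column (side y) ∷ []))
  distinct-independent side side-inj {x} {y} x≢y =
    IndependentColumns-cong {N = columns A (g ∘ (side x ∷ side y ∷ []))}
      {N′ = asColumns (column (side x) ∷ column (side y) ∷ [])}
      (independent (side x ∷ side y ∷ []) (pair-injective (x≢y ∘ side-inj)) (distinct-pairs-independent (x≢y ∘ side-inj)))
      (λ { i 0F → refl ; i 1F → refl })

  -- The implicit arguments reduce to ⊤ for concrete x y z, so they are found by computation.
  dependent-triple : ∀ (x y z : Fin 8) {_ : True (injective? (x ∷ y ∷ z ∷ []))}
    {_ : False (u24⊕u24? (image (x ∷ y ∷ z ∷ [])))} →
    ¬ IndependentColumns (asColumns (column x ∷ column y ∷ column z ∷ []))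
  dependent-triple x y z {inj} {dep} ind = dependent (x ∷ y ∷ z ∷ []) (λ {a} {b} → toWitness inj a b)
    (toWitnessFalse dep) (IndependentColumns-cong {N = asColumns (column x ∷ column y ∷ column z ∷ [])}
      {N′ = columns A (g ∘ (x ∷ y ∷ z ∷ []))} ind (λ { i 0F → refl ; i 1F → refl ; i 2F → refl }))

  open Minor4

  Δ-columns : ∀ ρ (x y z w : Fin 8) → Δ ρ (column x) (column y) (column z) (column w) ≡ det (λ r c → A (ρ r) (g ((x ∷ y ∷ z ∷ w ∷ []) c)))
  Δ-columns ρ x y z w =
    det-cong {M = restrict ρ (column x ∷ column y ∷ column z ∷ column w ∷ [])}
             {N = λ r c → A (ρ r) (g ((x ∷ y ∷ z ∷ w ∷ []) c))} λ { r 0F → refl ; r 1F → refl ; r 2F → refl ; r 3F → refl }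

  not-two-modular : ¬ TwoModular A
  not-two-modular A-2mod =
    independent⇒¬¬nonzero-minor (columns A (g ∘ basis)) (independent basis basis-injective (from-yes (u24⊕u24? (image basis)))) λ (ρ , D₀≢0) →
    ¬¬u24Coordinates (column ∘ side₁) (distinct-independent side₁ (↑ˡ-injective 4 _ _)) (dependent-triple 2F 0F 1F) (dependent-triple 3F 0F 1F) λ C →
    ¬¬u24Coordinates (column ∘ side₂) (distinct-independent side₂ (↑ʳ-injective 4 _ _)) (dependent-triple 6F 4F 5F) (dependent-triple 7F 4F 5F) λ D →
    u24-pair-minors-unbounded ρ C D (D₀≢0 ∘ trans (sym (Δ-columns ρ 0F 1F 4F 5F)))
      λ x y z w → subst (ℕ._≤ 2) (cong ℤ.∣_∣ (sym (Δ-columns ρ (side₁ x) (side₁ y) (side₂ z) (side₂ w))))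
                        (A-2mod 4 rank≡4 ρ (g ∘ (side₁ x ∷ side₁ y ∷ side₂ z ∷ side₂ w ∷ [])))

U24⊕U24∉M₂ : ¬ InM₂ ⊤ U24⊕U24
U24⊕U24∉M₂ (k , m , A , A-2mod , f , f-inj , _ , f-onto , represents) =
  U24⊕U24Representation.not-two-modular {A = A} f-inj (λ x → f-onto x ∈⊤) (λ X → represents X (λ _ → ∈⊤)) A-2mod

-- Minors of direct sums

module _ {a b : ℕ} (M : IndepSys a) (N : IndepSys b) where

  private
    take-insertˡ : ∀ (e : Fin a) B → take a (⁅ e ↑ˡ b ⁆ ∪ B) ≡ ⁅ e ⁆ ∪ take a B
    take-insertˡ e B = begin
      take a (⁅ e ↑ˡ b ⁆ ∪ B)         ≡⟨ take-∪ a _ B ⟩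
      take a ⁅ e ↑ˡ b ⁆ ∪ take a B     ≡⟨ cong (λ s → take a s ∪ take a B) (⁅↑ˡ⁆ b e) ⟩
      take a (⁅ e ⁆ ++ ⊥ {b}) ∪ take a B   ≡⟨ cong (_∪ take a B) (take-++ a ⁅ e ⁆ (⊥ {b})) ⟩
      ⁅ e ⁆ ∪ take a B                 ∎

    drop-insertˡ : ∀ (e : Fin a) B → drop a (⁅ e ↑ˡ b ⁆ ∪ B) ≡ drop a B
    drop-insertˡ e B = begin
      drop a (⁅ e ↑ˡ b ⁆ ∪ B)         ≡⟨ drop-∪ a _ B ⟩
      drop a ⁅ e ↑ˡ b ⁆ ∪ drop a B     ≡⟨ cong (λ s → drop a s ∪ drop a B) (⁅↑ˡ⁆ b e) ⟩
      drop a (⁅ e ⁆ ++ ⊥ {b}) ∪ drop a B   ≡⟨ cong (_∪ drop a B) (drop-++ a ⁅ e ⁆ (⊥ {b})) ⟩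
      ⊥ ∪ drop a B                     ≡⟨ ∪-identityˡ (drop a B) ⟩
      drop a B                         ∎

    take-insertʳ : ∀ (e : Fin b) B → take a (⁅ a ↑ʳ e ⁆ ∪ B) ≡ take a B
    take-insertʳ e B = begin
      take a (⁅ a ↑ʳ e ⁆ ∪ B)         ≡⟨ take-∪ a _ B ⟩
      take a ⁅ a ↑ʳ e ⁆ ∪ take a B     ≡⟨ cong (λ s → take a s ∪ take a B) (⁅↑ʳ⁆ a e) ⟩
      take a (⊥ {a} ++ ⁅ e ⁆) ∪ take a B   ≡⟨ cong (_∪ take a B) (take-++ a (⊥ {a}) ⁅ e ⁆) ⟩
      ⊥ ∪ take a B                     ≡⟨ ∪-identityˡ (take a B) ⟩
      take a B                         ∎

    drop-insertʳ : ∀ (e : Fin b) B → drop a (⁅ a ↑ʳ e ⁆ ∪ B) ≡ ⁅ e ⁆ ∪ drop a B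
    drop-insertʳ e B = begin
      drop a (⁅ a ↑ʳ e ⁆ ∪ B)         ≡⟨ drop-∪ a _ B ⟩
      drop a ⁅ a ↑ʳ e ⁆ ∪ drop a B     ≡⟨ cong (λ s → drop a s ∪ drop a B) (⁅↑ʳ⁆ a e) ⟩
      drop a (⊥ {a} ++ ⁅ e ⁆) ∪ drop a B   ≡⟨ cong (_∪ drop a B) (drop-++ a (⊥ {a}) ⁅ e ⁆) ⟩
      ⁅ e ⁆ ∪ drop a B                 ∎

  basis-take : ∀ {C B} → IsBasisOf (M ⊕ N) C B → IsBasisOf M (take a C) (take a B)
  basis-take {C} {B} (B⊆C , (MB , NB) , maximal) = ⊆-take a B⊆C , MB , λ e e∈C e∉B M[e∪B] →
    maximal (e ↑ˡ b) (∈-take⁻ a C e∈C) (e∉B ∘ ∈-take⁺ a B)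
      (subst M (sym (take-insertˡ e B)) M[e∪B] , subst N (sym (drop-insertˡ e B)) NB)

  basis-drop : ∀ {C B} → IsBasisOf (M ⊕ N) C B → IsBasisOf N (drop a C) (drop a B)
  basis-drop {C} {B} (B⊆C , (MB , NB) , maximal) = ⊆-drop a B⊆C , NB , λ e e∈C e∉B N[e∪B] →
    maximal (a ↑ʳ e) (∈-drop⁻ a C e∈C) (e∉B ∘ ∈-drop⁺ a B)
      (subst M (sym (take-insertʳ e B)) MB , subst N (sym (drop-insertʳ e B)) N[e∪B])

  basis-++ : ∀ {C B₁ B₂} → IsBasisOf M (take a C) B₁ → IsBasisOf N (drop a C) B₂ → IsBasisOf (M ⊕ N) C (B₁ ++ B₂)
  basis-++ {C} {B₁} {B₂} (B₁⊆ , MB₁ , maximal₁) (B₂⊆ , NB₂ , maximal₂) =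
    ⊆-split a (subst (_⊆ take a C) (sym t) B₁⊆) (subst (_⊆ drop a C) (sym d) B₂⊆) ,
    (subst M (sym t) MB₁ , subst N (sym d) NB₂) , maximal
    where
    t = take-++ a B₁ B₂
    d = drop-++ a B₁ B₂
    maximal : ∀ x → x ∈ C → x ∉ B₁ ++ B₂ → ¬ (M ⊕ N) (⁅ x ⁆ ∪ (B₁ ++ B₂))
    maximal x x∈C x∉B (M[x∪B] , N[x∪B]) with splitView a x
    ... | left e = maximal₁ e (∈-take⁺ a C x∈C) (x∉B ∘ ∈-take⁻ a (B₁ ++ B₂) ∘ subst (e ∈_) (sym t))
                     (subst M (trans (take-insertˡ e (B₁ ++ B₂)) (cong (⁅ e ⁆ ∪_) t)) M[x∪B])
    ... | right e = maximal₂ e (∈-drop⁺ a C x∈C) (x∉B ∘ ∈-drop⁻ a (B₁ ++ B₂) ∘ subst (e ∈_) (sym d))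
                      (subst N (trans (drop-insertʳ e (B₁ ++ B₂)) (cong (⁅ e ⁆ ∪_) d)) N[x∪B])

  minor-⊕ : ∀ C D X → minor (M ⊕ N) C D X ⇔ (minor M (take a C) (take a D) (take a X) × minor N (drop a C) (drop a D) (drop a X))
  minor-⊕ C D X = mk⇔ split combine
    where
    split : minor (M ⊕ N) C D X → minor M (take a C) (take a D) (take a X) × minor N (drop a C) (drop a D) (drop a X)
    split (X⊆ , B , basis , (M[X∪B] , N[X∪B])) =
      (subst (take a X ⊆_) (take-∁∪ a C D) (⊆-take a X⊆) , take a B , basis-take basis , subst M (take-∪ a X B) M[X∪B]) ,
      (subst (drop a X ⊆_) (drop-∁∪ a C D) (⊆-drop a X⊆) , drop a B , basis-drop basis , subst N (drop-∪ a X B) N[X∪B])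
    combine : minor M (take a C) (take a D) (take a X) × minor N (drop a C) (drop a D) (drop a X) → minor (M ⊕ N) C D X
    combine ((X₁⊆ , B₁ , basis₁ , M[X∪B₁]) , (X₂⊆ , B₂ , basis₂ , N[X∪B₂])) =
      ⊆-split a (subst (take a X ⊆_) (sym (take-∁∪ a C D)) X₁⊆) (subst (drop a X ⊆_) (sym (drop-∁∪ a C D)) X₂⊆) ,
      B₁ ++ B₂ , basis-++ basis₁ basis₂ ,
      (subst M (sym (trans (take-∪ a X (B₁ ++ B₂)) (cong (take a X ∪_) (take-++ a B₁ B₂)))) M[X∪B₁] ,
       subst N (sym (trans (drop-∪ a X (B₁ ++ B₂)) (cong (drop a X ∪_) (drop-++ a B₁ B₂)))) N[X∪B₂])

-- Certified representations

anyVec? : ∀ {m} t {P : Vec (Fin m) t → Set} → (∀ v → Dec (P v)) → Dec (∃ P)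
anyVec? zero P? = map′ (Vec.[] ,_) (λ { (Vec.[] , p) → p }) (P? Vec.[])
anyVec? (suc t) P? = map′ (λ (i , v , p) → i Vec.∷ v , p) (λ { (i Vec.∷ v , p) → i , v , p }) (any? λ i → anyVec? t (P? ∘ (i Vec.∷_)))

allVec? : ∀ {m} t {P : Vec (Fin m) t → Set} → (∀ v → Dec (P v)) → Dec (∀ v → P v)
allVec? zero P? = map′ (λ p → λ { Vec.[] → p }) (λ all → all Vec.[]) (P? Vec.[])
allVec? (suc t) P? = map′ (λ all → λ { (i Vec.∷ v) → all i v }) (λ all i v → all (i Vec.∷ v)) (all? λ i → allVec? t (P? ∘ (i Vec.∷_)))

allSubset? : ∀ {n} {P : Subset n → Set} → (∀ p → Dec (P p)) → Dec (∀ p → P p)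
allSubset? P? with anySubset? (λ p → ¬? (P? p))
... | yes (p , ¬Pp) = no λ all → ¬Pp (all p)
... | no none = yes λ p → decidable-stable (P? p) λ ¬Pp → none (p , ¬Pp)

module Certificates {m k} (A : Mat m k) where

  minorOf : (Y : Subset k) → Vec (Fin m) ∣ Y ∣ → ℤ
  minorOf Y v = det (columns A (enumerate Y) ∘ lookup v)

  NonzeroMinor : Subset k → Set
  NonzeroMinor Y = ∃ λ v → minorOf Y v ≢ 0ℤ

  VanishingMinors : Subset k → Set
  VanishingMinors Y = ∀ v → minorOf Y v ≡ 0ℤ

  nonzeroMinor? : ∀ Y → Dec (NonzeroMinor Y)
  nonzeroMinor? Y = anyVec? ∣ Y ∣ λ v → ¬? (minorOf Y v ≟ 0ℤ)

  vanishingMinors? : ∀ Y → Dec (VanishingMinors Y)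
  vanishingMinors? Y = allVec? ∣ Y ∣ λ v → minorOf Y v ≟ 0ℤ

  nonzeroMinor⇒ColIndep : ∀ {Y} → NonzeroMinor Y → ColIndep A Y
  nonzeroMinor⇒ColIndep {Y} (v , minor≢0) = independent⇒ColIndep A (enumerate-injective Y) (λ j → enumerate-onto Y)
    (nonzero-minor⇒independent (columns A (enumerate Y)) (lookup v) minor≢0)

  vanishingMinors⇒dependent : ∀ {Y Z} → Z ⊆ Y → VanishingMinors Z → ¬ ColIndep A Y
  vanishingMinors⇒dependent {Y} {Z} Z⊆Y vanish Y-ind =
    minors-vanish⇒dependent ∣ Z ∣ (columns A (enumerate Z)) vanish′
      (ColIndep⇒independent A (enumerate-injective Z) (Z⊆Y ∘ enumerate-∈ Z) Y-ind)
    where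
    vanish′ : ∀ R → det (columns A (enumerate Z) ∘ R) ≡ 0ℤ
    vanish′ R = trans (det-cong λ a b → cong (λ r → A r (enumerate Z b)) (sym (lookup∘tabulate R a))) (vanish (tabulate R))

  -- Z is meant to be a small circuit inside Y: enumerating the maximal minors of a large dependent Y would be too costly.
  Certificate : IndepSys k → Subset k → Subset k → Set
  Certificate I Y Z = (I Y × NonzeroMinor Y) ⊎ (¬ I Y × Z ⊆ Y × VanishingMinors Z)

  certificate? : ∀ {I} → (∀ Y → Dec (I Y)) → ∀ Y Z → Dec (Certificate I Y Z)
  certificate? I? Y Z = (I? Y ×-dec nonzeroMinor? Y) ⊎-dec (¬? (I? Y) ×-dec ((Z ⊆? Y) ×-dec vanishingMinors? Z))

  certificate⇒represents : ∀ {I Y Z} → Certificate I Y Z → I Y ⇔ ColIndep A Y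
  certificate⇒represents (inj₁ (IY , minor)) = mk⇔ (λ _ → nonzeroMinor⇒ColIndep minor) (λ _ → IY)
  certificate⇒represents (inj₂ (¬IY , Z⊆Y , vanish)) = mk⇔ (⊥-elim ∘ ¬IY) (⊥-elim ∘ vanishingMinors⇒dependent Z⊆Y vanish)

  BoundedMaximalMinors : Set
  BoundedMaximalMinors = ∀ (cols : Vec (Fin k) m) → ℤ.∣ det (λ a b → A a (lookup cols b)) ∣ ℕ.≤ 2

  boundedMaximalMinors? : Dec BoundedMaximalMinors
  boundedMaximalMinors? = allVec? m λ cols → ℤ.∣ det (λ a b → A a (lookup cols b)) ∣ ℕ.≤? 2

  full-rank-two-modular : (∃ λ S → ColIndep A S × ∣ S ∣ ≡ m) → BoundedMaximalMinors → TwoModular A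
  full-rank-two-modular (S₀ , S₀-ind , ∣S₀∣≡m) bounded r ((S , S-ind , ∣S∣≡r) , maximal) with rank≡m
    where
    rank≡m : r ≡ m
    rank≡m = ℕ.≤-antisym
      (subst (ℕ._≤ m) ∣S∣≡r (independent⇒≤rows (columns A (enumerate S)) (ColIndep⇒independent A (enumerate-injective S) (enumerate-∈ S) S-ind)))
      (subst (ℕ._≤ r) ∣S₀∣≡m (maximal S₀ S₀-ind))
  ... | refl = λ rows cols → bound rows cols
    where
    bound : ∀ (rows : Fin m → Fin m) (cols : Fin m → Fin k) → ℤ.∣ det (λ a b → A (rows a) (cols b)) ∣ ℕ.≤ 2
    bound rows cols with any? (λ a → any? λ b → (rows a ≟ᶠ rows b) ×-dec ¬? (a ≟ᶠ b))
    ... | yes (a , b , ra≡rb , a≢b) =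
      subst (ℕ._≤ 2) (cong ℤ.∣_∣ (sym (det-repeated-row (λ a b → A (rows a) (cols b)) a≢b λ c → cong (λ r → A r (cols c)) ra≡rb))) ℕ.z≤n
    ... | no no-repeat = subst (ℕ._≤ 2) (sym (trans (∣det∣-permute-rows (λ a b → A a (cols b)) rows-inj) (cong ℤ.∣_∣ tabulated))) (bounded (tabulate cols))
      where
      rows-inj : ∀ {a b} → rows a ≡ rows b → a ≡ b
      rows-inj {a} {b} ra≡rb = decidable-stable (a ≟ᶠ b) λ a≢b → no-repeat (a , b , ra≡rb , a≢b)
      tabulated : det (λ a b → A a (cols b)) ≡ det (λ a b → A a (lookup (tabulate cols) b))
      tabulated = det-cong λ a b → cong (A a) (sym (lookup∘tabulate cols b))

-- Proper minors of U₂,₄ ⊕ U₂,₄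

_⇔?_ : ∀ {P Q : Set} → Dec P → Dec Q → Dec (P ⇔ Q)
yes p ⇔? yes q = yes (mk⇔ (λ _ → q) (λ _ → p))
yes p ⇔? no ¬q = no λ p⇔q → ¬q (Equivalence.to p⇔q p)
no ¬p ⇔? yes q = no λ p⇔q → ¬p (Equivalence.from p⇔q q)
no ¬p ⇔? no ¬q = yes (mk⇔ (λ p → ⊥-elim (¬p p)) (λ q → ⊥-elim (¬q q)))

U? : ∀ r {n} X → Dec (U r n X)
U? r X = ∣ X ∣ ℕ.≤? r

IsBasisOf-U24? : ∀ C B → Dec (IsBasisOf (U 2 4) C B)
IsBasisOf-U24? C B = (B ⊆? C) ×-dec (U? 2 B ×-dec all? λ e → (e ∈? C) →-dec (¬? (e ∈? B) →-dec ¬? (U? 2 (⁅ e ⁆ ∪ B))))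

minor-U24? : ∀ C D X → Dec (minor (U 2 4) C D X)
minor-U24? C D X = (X ⊆? ∁ (C ∪ D)) ×-dec anySubset? λ B → IsBasisOf-U24? C B ×-dec U? 2 (X ∪ B)

-- Truncated subtraction makes the rank 0 once C has more than two elements.
minorRank : Subset 4 → Subset 4 → ℕ
minorRank C D = (2 ∸ ∣ C ∣) ⊓ ∣ ∁ (C ∪ D) ∣

minor-U24-uniform : ∀ C D X → X ⊆ ∁ (C ∪ D) →
  minor (U 2 4) C D X ⇔ U (minorRank C D) ∣ ∁ (C ∪ D) ∣ (preimage (enumerate (∁ (C ∪ D))) X)
minor-U24-uniform = from-yes (allSubset? λ C → allSubset? λ D → allSubset? λ X →
  (X ⊆? ∁ (C ∪ D)) →-dec (minor-U24? C D X ⇔? U? (minorRank C D) (preimage (enumerate (∁ (C ∪ D))) X)))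

U24-minor-types : Fin 9 → ℕ × ℕ
U24-minor-types = (0 , 0) ∷ (0 , 1) ∷ (0 , 2) ∷ (1 , 1) ∷ (1 , 2) ∷ (1 , 3) ∷ (2 , 2) ∷ (2 , 3) ∷ (2 , 4) ∷ []

U24-minor-type : ∀ C D → ∃ λ i → U24-minor-types i ≡ (minorRank C D , ∣ ∁ (C ∪ D) ∣)
U24-minor-type = from-yes (allSubset? λ C → allSubset? λ D → any? λ i → ≡-dec ℕ._≟_ ℕ._≟_ (U24-minor-types i) (minorRank C D , ∣ ∁ (C ∪ D) ∣))

firstRow secondRow : ℕ → ℤ
firstRow 1 = 0ℤ
firstRow _ = 1ℤ
secondRow 0 = 0ℤ
secondRow 1 = 1ℤ
secondRow 2 = 1ℤ
secondRow _ = -1ℤ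

-- U_{1,n} is represented by a row of ones, U_{2,n} by the first n of the columns (1 0)ᵀ, (0 1)ᵀ, (1 1)ᵀ, (1 -1)ᵀ.
uniformMatrix : (r n : ℕ) → Mat r n
uniformMatrix 1 n _ _ = 1ℤ
uniformMatrix 2 n zero j = firstRow (toℕ j)
uniformMatrix 2 n (suc zero) j = secondRow (toℕ j)
uniformMatrix _ _ _ _ = 0ℤ

blockDiagonal : ∀ {r₁ n₁ r₂ n₂} → Mat r₁ n₁ → Mat r₂ n₂ → Mat (r₁ ℕ.+ r₂) (n₁ ℕ.+ n₂)
blockDiagonal {r₁} {n₁} P Q i j with splitAt r₁ i | splitAt n₁ j
... | inj₁ a | inj₁ b = P a b
... | inj₂ a | inj₂ b = Q a b
... | _      | _      = 0ℤ

firstK : ∀ {n} → ℕ → Subset n → Subset n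
firstK t Vec.[] = Vec.[]
firstK zero (x Vec.∷ p) = ⊥
firstK (suc t) (true Vec.∷ p) = true Vec.∷ firstK t p
firstK (suc t) (false Vec.∷ p) = false Vec.∷ firstK (suc t) p

module Canonical (r₁ n₁ r₂ n₂ : ℕ) where

  A : Mat (r₁ ℕ.+ r₂) (n₁ ℕ.+ n₂)
  A = blockDiagonal (uniformMatrix r₁ n₁) (uniformMatrix r₂ n₂)

  open Certificates A

  I? : ∀ Y → Dec ((U r₁ n₁ ⊕ U r₂ n₂) Y)
  I? Y = U? r₁ (take n₁ Y) ×-dec U? r₂ (drop n₁ Y)

  circuit : Subset (n₁ ℕ.+ n₂) → Subset (n₁ ℕ.+ n₂)
  circuit Y with U? r₁ (take n₁ Y)
  ... | yes _ = ⊥ {n₁} ++ firstK (suc r₂) (drop n₁ Y)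
  ... | no _ = firstK (suc r₁) (take n₁ Y) ++ ⊥ {n₂}

  basis : Subset (n₁ ℕ.+ n₂)
  basis = firstK r₁ (⊤ {n₁}) ++ firstK r₂ ⊤

  Valid : Set
  Valid = (∀ Y → Certificate (U r₁ n₁ ⊕ U r₂ n₂) Y (circuit Y)) × (U r₁ n₁ ⊕ U r₂ n₂) basis × ∣ basis ∣ ≡ r₁ ℕ.+ r₂ × BoundedMaximalMinors

  valid? : Dec Valid
  valid? = allSubset? (λ Y → certificate? I? Y (circuit Y)) ×-dec (I? basis ×-dec ((∣ basis ∣ ℕ.≟ r₁ ℕ.+ r₂) ×-dec boundedMaximalMinors?))

ValidFor : ℕ × ℕ → ℕ × ℕ → Set
ValidFor (r₁ , n₁) (r₂ , n₂) = Canonical.Valid r₁ n₁ r₂ n₂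

all-valid : ∀ i j → (proj₂ (U24-minor-types i) , proj₂ (U24-minor-types j)) ≢ (4 , 4) → ValidFor (U24-minor-types i) (U24-minor-types j)
all-valid = from-yes (all? λ i → all? λ j →
  ¬? (≡-dec ℕ._≟_ ℕ._≟_ (proj₂ (U24-minor-types i) , proj₂ (U24-minor-types j)) (4 , 4)) →-dec valid? (U24-minor-types i) (U24-minor-types j))
  where
  valid? : ∀ t₁ t₂ → Dec (ValidFor t₁ t₂)
  valid? (r₁ , n₁) (r₂ , n₂) = Canonical.valid? r₁ n₁ r₂ n₂

module ProperMinor (C D : Subset 8) (nonempty : Nonempty (C ∪ D)) where

  E E₁ E₂ : Subset _
  E = ∁ (C ∪ D)
  E₁ = ∁ (take 4 C ∪ take 4 D)
  E₂ = ∁ (drop 4 C ∪ drop 4 D)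
  r₁ = minorRank (take 4 C) (take 4 D)
  r₂ = minorRank (drop 4 C) (drop 4 D)
  n₁ = ∣ E₁ ∣
  n₂ = ∣ E₂ ∣

  not-both-full : (n₁ , n₂) ≢ (4 , 4)
  not-both-full eq with splitView 4 (proj₁ nonempty)
  ... | left e = ∈⇒∣∁∣≢n (subst (e ∈_) (take-∪ 4 C D) (∈-take⁺ 4 (C ∪ D) (proj₂ nonempty))) (cong proj₁ eq)
  ... | right e = ∈⇒∣∁∣≢n (subst (e ∈_) (drop-∪ 4 C D) (∈-drop⁺ 4 (C ∪ D) (proj₂ nonempty))) (cong proj₂ eq)

  open Canonical r₁ n₁ r₂ n₂

  valid : Valid
  valid with U24-minor-type (take 4 C) (take 4 D) | U24-minor-type (drop 4 C) (drop 4 D)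
  ... | i , tᵢ≡ | j , tⱼ≡ =
    subst₂ ValidFor tᵢ≡ tⱼ≡ (all-valid i j (not-both-full ∘ subst₂ (λ t t′ → (proj₂ t , proj₂ t′) ≡ (4 , 4)) tᵢ≡ tⱼ≡))

  f : Fin (n₁ ℕ.+ n₂) → Fin 8
  f = enumerate E₁ ⊕ᶠ enumerate E₂

  represents : ∀ X → X ⊆ E → minor U24⊕U24 C D X ⇔ VecMatroid A (preimage f X)
  represents X X⊆E = ⇔-trans (minor-⊕ (U 2 4) (U 2 4) C D X) (⇔-trans (uniform₁ ×-⇔ uniform₂) (⇔-trans relabel certified))
    where
    open Certificates A
    uniform₁ = minor-U24-uniform _ _ _ (subst (take 4 X ⊆_) (take-∁∪ 4 C D) (⊆-take 4 X⊆E))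
    uniform₂ = minor-U24-uniform _ _ _ (subst (drop 4 X ⊆_) (drop-∁∪ 4 C D) (⊆-drop 4 X⊆E))
    relabel : (U r₁ n₁ (preimage (enumerate E₁) (take 4 X)) × U r₂ n₂ (preimage (enumerate E₂) (drop 4 X))) ⇔ (U r₁ n₁ ⊕ U r₂ n₂) (preimage f X)
    relabel = subst₂ (λ P Q → (U r₁ n₁ (preimage (enumerate E₁) (take 4 X)) × U r₂ n₂ (preimage (enumerate E₂) (drop 4 X))) ⇔ (U r₁ n₁ P × U r₂ n₂ Q))
      (sym (take-preimage-⊕ᶠ (enumerate E₁) (enumerate E₂) X)) (sym (drop-preimage-⊕ᶠ (enumerate E₁) (enumerate E₂) X)) (mk⇔ id id)
    certified = certificate⇒represents {I = U r₁ n₁ ⊕ U r₂ n₂} (proj₁ valid (preimage f X))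

  inM₂ : InM₂ E (minor U24⊕U24 C D)
  inM₂ = n₁ ℕ.+ n₂ , r₁ ℕ.+ r₂ , A , two-modular , f ,
         ⊕ᶠ-injective f₁ f₂ (enumerate-injective E₁) (enumerate-injective E₂) ,
         ⊕ᶠ-∈ f₁ f₂ (λ i → subst (f₁ i ∈_) (sym (take-∁∪ 4 C D)) (enumerate-∈ E₁ i)) (λ j → subst (f₂ j ∈_) (sym (drop-∁∪ 4 C D)) (enumerate-∈ E₂ j)) ,
         (λ x → ⊕ᶠ-onto f₁ f₂ (enumerate-onto E₁ ∘ subst (_ ∈_) (take-∁∪ 4 C D)) (enumerate-onto E₂ ∘ subst (_ ∈_) (drop-∁∪ 4 C D))) ,
         represents
    where
    open Certificates A
    f₁ = enumerate E₁
    f₂ = enumerate E₂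
    basis-ind = certificate⇒represents {I = U r₁ n₁ ⊕ U r₂ n₂} (proj₁ valid basis)
    two-modular : TwoModular A
    two-modular = full-rank-two-modular (basis , Equivalence.to basis-ind (proj₁ (proj₂ valid)) , proj₁ (proj₂ (proj₂ valid))) (proj₂ (proj₂ (proj₂ valid)))

proposition4p3 : ¬ InM₂ ⊤ U24⊕U24 ×
    ((C D : Subset 8) → Empty (C ∩ D) → Nonempty (C ∪ D) →
      InM₂ (∁ (C ∪ D)) (minor U24⊕U24 C D))
proposition4p3 = U24⊕U24∉M₂ , λ C D _ nonempty → ProperMinor.inM₂ C D nonempty
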